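{- Let $F(x)=\sum_{k\ge0}c_kx^k$ be a formal power series with coefficients $c_k\in\mathbb{Q}(q)$, and let $v\ge0$ be an integer. Then $$F(1/z)\,\Omega[(q-1)zX_n]\Big|_{z^v}=\frac{\chi(v=0)}{q^n}F(0)+\frac{q-1}{q^n}\sum_{i=1}^n\Big(\prod_{j\ne i}\frac{qx_i-x_j}{x_i-x_j}\Big)(qx_i)^vF(qx_i).$$
   Context: $X_n=x_1+\cdots+x_n$ and $\Omega[(q-1)zX_n]=\prod_{i=1}^n\frac{1-zx_i}{1-qzx_i}$, expanded as a power series in $z$; $F(1/z)\Omega[(q-1)zX_n]|_{z^v}$ is the coefficient of $z^v$ in the product, computed as a formal power series in $x_1,\dots,x_n$. $\chi(v=0)$ is $1$ if $v=0$ and $0$ otherwise. -}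

module Defs where

open import Data.Nat as ℕ using (ℕ; zero; suc)
open import Data.Integer as ℤ using (ℤ; +_)
open import Data.List as L using (List; []; _∷_)
open import Data.Vec as V using (Vec; []; _∷_)
open import Data.Fin as F using (Fin)
open import Data.Bool using (Bool; true; false; if_then_else_; _∨_)
open import Data.Product using (_×_; _,_)
open import Relation.Nullary using (¬_; does)
open import Relation.Binary.PropositionalEquality using (_≡_)
import Data.Vec.Properties as VP

-- ℤ[q]: polynomials in q with integer coefficients (lists of
-- coefficients, constant term first; trailing zeros allowed).

Poly : Set
Poly = List ℤ

coeffP : Poly → ℕ → ℤ
coeffP []      _       = + 0
coeffP (a ∷ p) zero    = a
coeffP (a ∷ p) (suc k) = coeffP p k

_≈P_ : Poly → Poly → Set
p ≈P r = ∀ k → coeffP p k ≡ coeffP r k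

addP : Poly → Poly → Poly
addP []      r       = r
addP (a ∷ p) []      = a ∷ p
addP (a ∷ p) (b ∷ r) = (a ℤ.+ b) ∷ addP p r

mulP : Poly → Poly → Poly
mulP []      r = []
mulP (a ∷ p) r = addP (L.map (a ℤ.*_) r) (+ 0 ∷ mulP p r)

negP : Poly → Poly
negP = L.map (λ a → ℤ.- a)

-- ℚ(q) = Frac(ℤ[q]): fractions num/den.  All
-- denominators produced from inputs with nonzero denominators are
-- nonzero (ℤ[q] is a domain), so _≈K_ is equality in ℚ(q).

record K : Set where
  constructor _/ₖ_
  field
    num : Poly
    den : Poly
open K public

NonZeroDen : K → Set
NonZeroDen a = ¬ (den a ≈P [])

_≈K_ : K → K → Set
a ≈K b = mulP (num a) (den b) ≈P mulP (num b) (den a)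

0K 1K qK : K
0K = [] /ₖ (+ 1 ∷ [])
1K = (+ 1 ∷ []) /ₖ (+ 1 ∷ [])
qK = (+ 0 ∷ + 1 ∷ []) /ₖ (+ 1 ∷ [])

_+K_ : K → K → K
a +K b = addP (mulP (num a) (den b)) (mulP (num b) (den a)) /ₖ mulP (den a) (den b)

_*K_ : K → K → K
a *K b = mulP (num a) (num b) /ₖ mulP (den a) (den b)

-K_ : K → K
-K a = negP (num a) /ₖ den a

_-K_ : K → K → K
a -K b = a +K (-K b)

_^K_ : K → ℕ → K
a ^K zero  = 1K
a ^K suc m = a *K (a ^K m)

sumK : List K → K
sumK = L.foldr _+K_ 0K

MIdx : ℕ → Set
MIdx n = Vec ℕ n

PS : ℕ → Set
PS n = MIdx n → K

_≈S_ : ∀ {n} → PS n → PS n → Set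
f ≈S g = ∀ α → f α ≈K g α

∣_∣ : ∀ {n} → MIdx n → ℕ
∣ α ∣ = V.sum α

below : ∀ {n} → MIdx n → List (MIdx n)
below []      = [] ∷ []
below (a ∷ α) = L.concatMap (λ b → L.map (b ∷_) (below α)) (L.upTo (suc a))

_-ᵢ_ : ∀ {n} → MIdx n → MIdx n → MIdx n
α -ᵢ β = V.zipWith ℕ._∸_ α β

constS : ∀ {n} → K → PS n
constS {n} c α = if does (VP.≡-dec ℕ._≟_ α (V.replicate n 0)) then c else 0K

unitIdx : ∀ {n} → Fin n → MIdx n
unitIdx i = V.tabulate (λ j → if does (i F.≟ j) then 1 else 0)

varS : ∀ {n} → Fin n → PS n
varS i α = if does (VP.≡-dec ℕ._≟_ α (unitIdx i)) then 1K else 0K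

_+S_ : ∀ {n} → PS n → PS n → PS n
(f +S g) α = f α +K g α

-S_ : ∀ {n} → PS n → PS n
(-S f) α = -K f α

_-S_ : ∀ {n} → PS n → PS n → PS n
f -S g = f +S (-S g)

_·S_ : ∀ {n} → K → PS n → PS n
(c ·S f) α = c *K f α

_*S_ : ∀ {n} → PS n → PS n → PS n
(f *S g) α = sumK (L.map (λ β → f β *K g (α -ᵢ β)) (below α))

0S 1S : ∀ {n} → PS n
0S _ = 0K
1S = constS 1K

_^S_ : ∀ {n} → PS n → ℕ → PS n
f ^S zero  = 1S
f ^S suc m = f *S (f ^S m)

sumS : ∀ {n} → List (PS n) → PS n
sumS = L.foldr _+S_ 0S

prodS : ∀ {n} → List (PS n) → PS n
prodS = L.foldr _*S_ 1S

-- Infinite sum Σ_{k≥0} s k of a family in which the k-th term has no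
-- monomials of total degree < k (formally summable family): the
-- coefficient of x^α only receives contributions from k ≤ |α|.
sumInf : ∀ {n} → (ℕ → PS n) → PS n
sumInf s α = sumK (L.map (λ k → s k α) (L.upTo (suc ∣ α ∣)))

-- Power series in z with coefficients in ℚ(q)[[x₁,…,xₙ]].

PSz : ℕ → Set
PSz n = ℕ → PS n

_*z_ : ∀ {n} → PSz n → PSz n → PSz n
(f *z g) m = sumS (L.map (λ k → f k *S g (m ℕ.∸ k)) (L.upTo (suc m)))

1z : ∀ {n} → PSz n
1z zero    = 1S
1z (suc _) = 0S

oneMinusZx : ∀ {n} → Fin n → PSz n
oneMinusZx i zero          = 1S
oneMinusZx i (suc zero)    = -S varS i
oneMinusZx i (suc (suc _)) = 0S

-- 1/(1 - q z xᵢ) = Σ_m (q xᵢ)^m z^m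
geomQZx : ∀ {n} → Fin n → PSz n
geomQZx i m = (qK ·S varS i) ^S m

-- Ω[(q-1) z Xₙ] = ∏ᵢ (1 - z xᵢ)/(1 - q z xᵢ)
Omega : (n : ℕ) → PSz n
Omega n = L.foldr (λ i acc → (oneMinusZx i *z geomQZx i) *z acc) 1z (L.allFin n)

-- F(1/z) Ω[(q-1) z Xₙ] |_{z^v}  where F(x) = Σ_k c_k x^k:
-- Σ_k c_k · [z^{v+k}] Ω
lhsCoeff : (n : ℕ) → (ℕ → K) → ℕ → PS n
lhsCoeff n c v = sumInf (λ k → c k ·S Omega n (v ℕ.+ k))

evalQx : ∀ {n} → (ℕ → K) → Fin n → PS n
evalQx c i = sumInf (λ k → c k ·S ((qK ·S varS i) ^S k))

χ0 : ℕ → K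
χ0 zero    = 1K
χ0 (suc _) = 0K

-- Denominator clearing.  D = ∏_{a ≠ b} (x_a - x_b) over ordered pairs.
-- D / ∏_{j≠i}(xᵢ - xⱼ) = ∏_{a ≠ b, a ≠ i} (x_a - x_b) =: Dᵢ.

pairsExcept : ∀ {n} → (Fin n → Bool) → List (Fin n × Fin n)
pairsExcept {n} skip =
  L.concatMap (λ a → L.concatMap (λ b →
      if does (a F.≟ b) ∨ skip a then [] else (a , b) ∷ []) (L.allFin n))
    (L.allFin n)

diffS : ∀ {n} → Fin n × Fin n → PS n
diffS (a , b) = varS a -S varS b

Dall : (n : ℕ) → PS n
Dall n = prodS (L.map diffS (pairsExcept (λ _ → false)))

Dexcept : ∀ {n} → Fin n → PS n
Dexcept i = prodS (L.map diffS (pairsExcept (λ a → does (a F.≟ i))))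

numProd : ∀ {n} → Fin n → PS n
numProd {n} i = prodS (L.concatMap
  (λ j → if does (j F.≟ i) then [] else ((qK ·S varS i) -S varS j) ∷ [])
  (L.allFin n))

-- Write Δᵢ = ∏_{j≠i} (xᵢ - xⱼ) and Nᵢ = ∏_{j≠i} (q xᵢ - xⱼ). The partial fraction expansion
--   ∏ᵢ (q w - s xᵢ) / (w - s xᵢ) = 1 + (q - 1) w ∑ᵢ (Nᵢ / Δᵢ) / (w - s xᵢ),
-- proved by induction on n, gives at w = 1, s = q z
--   qⁿ Ω[(q - 1) z Xₙ] = ∏ᵢ (q - q z xᵢ) / (1 - q z xᵢ) = 1 + (q - 1) ∑ᵢ (Nᵢ / Δᵢ) ∑ₘ (q xᵢ z)ᵐ.
-- Multiplying the coefficient of z^(v + k) by c_k and summing over k yields the claim: the constant 1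
-- contributes only when v + k = 0, and ∑ₖ c_k (q xᵢ)^(v + k) = (q xᵢ)ᵛ F(q xᵢ).
-- Everything is multiplied by D = ∏_{a≠b} (x_a - x_b), so no division by xᵢ - xⱼ occurs. The
-- coefficients live in ℚ(q), realised as fractions over ℤ[q] with nonzero denominator; transitivity of
-- their cross-multiplication equality is where ℤ[q] being an integral domain is used.

module Submission where

open import Algebra.Bundles using (CommutativeRing; RawRing)
open import Algebra.Morphism.Structures using (IsRingHomomorphism; IsRingMonomorphism)
import Algebra.Morphism.RingMonomorphism as RingMonomorphism
open import Algebra.Solver.Ring.AlmostCommutativeRing using (fromCommutativeRing; _-Raw-AlmostCommutative⟶_)
open import Algebra.Structures using (IsCommutativeRing)
open import Data.Bool using (Bool; true; false; if_then_else_; _∨_)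
import Data.Bool.Properties as Bool
open import Data.Empty using (⊥-elim)
open import Data.Fin as Fin using (Fin; zero; suc)
open import Data.Integer as ℤ using (ℤ; +_; -[1+_]; _⊖_)
import Data.Integer.Properties as ℤ
open import Data.List as List using (List; []; _∷_; _++_; map; foldr; concatMap; applyUpTo; upTo; allFin; tabulate)
import Data.List.Properties as List
open import Data.List.Relation.Binary.Pointwise as Pointwise using (Pointwise; []; _∷_)
open import Data.List.Relation.Unary.All as All using (All; []; _∷_)
import Data.List.Relation.Unary.All.Properties as All
open import Data.Maybe using (Maybe; just; nothing)
open import Data.Nat as ℕ using (ℕ; zero; suc; _∸_; _<_; _≤_; s≤s)
import Data.Nat.Properties as ℕ
open import Data.Product using (_×_; _,_)
open import Data.Sign as Sign using (Sign)
open import Data.Sum as Sum using (_⊎_; inj₁; inj₂)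
open import Data.Vec as Vec using ([]; _∷_)
import Data.Vec.Properties as Vec
open import Data.Vec.Functional using (Vector)
open import Function using (_∘_; id)
open import Relation.Binary.Core using (Rel)
open import Relation.Binary.PropositionalEquality as ≡ using (_≡_)
import Relation.Binary.Reasoning.Setoid as SetoidReasoning
open import Relation.Binary.Bundles using (Setoid)
open import Relation.Binary.Structures using (IsEquivalence)
open import Relation.Nullary using (¬_; does; yes; no)
open import Relation.Nullary.Negation using (contradiction)
open import Defs

-- Coefficients come from ℤ through its canonical homomorphism into R: with R itself as the
-- coefficient ring (as in Tactic.RingSolver) nothing can be decided to be zero, so nothing cancels.
module RingSolver {c ℓ} (R : CommutativeRing c ℓ) where
  open CommutativeRing R
  open SetoidReasoning setoid
  open import Algebra.Properties.Ring ring using (-0#≈0#; -‿involutive; -‿distribˡ-*; -‿distribʳ-*; -‿+-comm)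
  open import Algebra.Properties.Semiring.Mult.TCOptimised semiring using (1+×; ×-homo-+; ×1-homo-*) renaming (_×_ to _×′_)

  private
    signed : Sign → Carrier → Carrier
    signed Sign.+ x = x
    signed Sign.- x = - x

    ⟦_⟧ : ℤ → Carrier
    ⟦ i ⟧ = signed (ℤ.sign i) (ℤ.∣ i ∣ ×′ 1#)

    ◃-homo : ∀ s n → ⟦ s ℤ.◃ n ⟧ ≈ signed s (n ×′ 1#)
    ◃-homo Sign.+ zero = refl
    ◃-homo Sign.- zero = sym -0#≈0#
    ◃-homo Sign.+ (suc n) = refl
    ◃-homo Sign.- (suc n) = refl

    signed-cong : ∀ s {x y} → x ≈ y → signed s x ≈ signed s y
    signed-cong Sign.+ e = e
    signed-cong Sign.- e = -‿cong e

    signed-* : ∀ s t x y → signed (s Sign.* t) (x * y) ≈ signed s x * signed t y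
    signed-* Sign.+ Sign.+ x y = refl
    signed-* Sign.+ Sign.- x y = -‿distribʳ-* x y
    signed-* Sign.- Sign.+ x y = -‿distribˡ-* x y
    signed-* Sign.- Sign.- x y = begin
      x * y          ≈⟨ -‿involutive (x * y) ⟨
      - - (x * y)    ≈⟨ -‿cong (-‿distribˡ-* x y) ⟩
      - (- x * y)    ≈⟨ -‿distribʳ-* (- x) y ⟩
      - x * - y      ∎

    *-homo : ∀ i j → ⟦ i ℤ.* j ⟧ ≈ ⟦ i ⟧ * ⟦ j ⟧
    *-homo i j = begin
      ⟦ s ℤ.◃ (ℤ.∣ i ∣ ℕ.* ℤ.∣ j ∣) ⟧                ≈⟨ ◃-homo s (ℤ.∣ i ∣ ℕ.* ℤ.∣ j ∣) ⟩
      signed s ((ℤ.∣ i ∣ ℕ.* ℤ.∣ j ∣) ×′ 1#)          ≈⟨ signed-cong s (×1-homo-* ℤ.∣ i ∣ ℤ.∣ j ∣) ⟩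
      signed s ((ℤ.∣ i ∣ ×′ 1#) * (ℤ.∣ j ∣ ×′ 1#))    ≈⟨ signed-* (ℤ.sign i) (ℤ.sign j) _ _ ⟩
      ⟦ i ⟧ * ⟦ j ⟧                                  ∎
      where
      s : Sign
      s = ℤ.sign i Sign.* ℤ.sign j

    ⊖-homo : ∀ m n → ⟦ m ⊖ n ⟧ ≈ m ×′ 1# - n ×′ 1#
    ⊖-homo zero zero = sym (trans (+-congˡ -0#≈0#) (+-identityʳ _))
    ⊖-homo zero (suc n) = sym (+-identityˡ _)
    ⊖-homo (suc m) zero = sym (trans (+-congˡ -0#≈0#) (+-identityʳ _))
    ⊖-homo (suc m) (suc n) = begin
      ⟦ suc m ⊖ suc n ⟧ ≡⟨ ≡.cong ⟦_⟧ (ℤ.[1+m]⊖[1+n]≡m⊖n m n) ⟩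
      ⟦ m ⊖ n ⟧ ≈⟨ ⊖-homo m n ⟩
      m ×′ 1# - n ×′ 1# ≈⟨ +-congʳ (+-identityˡ _) ⟨
      (0# + m ×′ 1#) - n ×′ 1# ≈⟨ +-congʳ (+-congʳ (-‿inverseʳ 1#)) ⟨
      ((1# - 1#) + m ×′ 1#) - n ×′ 1# ≈⟨ +-congʳ (+-assoc 1# (- 1#) (m ×′ 1#)) ⟩
      (1# + (- 1# + m ×′ 1#)) - n ×′ 1# ≈⟨ +-congʳ (+-congˡ (+-comm (- 1#) (m ×′ 1#))) ⟩
      (1# + (m ×′ 1# - 1#)) - n ×′ 1# ≈⟨ +-congʳ (+-assoc 1# (m ×′ 1#) (- 1#)) ⟨
      ((1# + m ×′ 1#) - 1#) - n ×′ 1# ≈⟨ +-assoc (1# + m ×′ 1#) (- 1#) (- (n ×′ 1#)) ⟩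
      (1# + m ×′ 1#) + (- 1# - n ×′ 1#) ≈⟨ +-congˡ (-‿+-comm 1# (n ×′ 1#)) ⟩
      (1# + m ×′ 1#) - (1# + n ×′ 1#) ≈⟨ +-cong (1+× m 1#) (-‿cong (1+× n 1#)) ⟨
      suc m ×′ 1# - suc n ×′ 1# ∎

    +-homo : ∀ i j → ⟦ i ℤ.+ j ⟧ ≈ ⟦ i ⟧ + ⟦ j ⟧
    +-homo -[1+ m ] -[1+ n ] = begin
      - (suc (suc (m ℕ.+ n)) ×′ 1#) ≡⟨ ≡.cong (λ k → - (suc k ×′ 1#)) (ℕ.+-suc m n) ⟨
      - ((suc m ℕ.+ suc n) ×′ 1#)   ≈⟨ -‿cong (×-homo-+ 1# (suc m) (suc n)) ⟩
      - (suc m ×′ 1# + suc n ×′ 1#)  ≈⟨ -‿+-comm _ _ ⟨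
      - (suc m ×′ 1#) - suc n ×′ 1#  ∎
    +-homo -[1+ m ] (+ n)    = trans (⊖-homo n (suc m)) (+-comm _ _)
    +-homo (+ m)    -[1+ n ] = ⊖-homo m (suc n)
    +-homo (+ m)    (+ n)    = ×-homo-+ 1# m n

    -‿homo : ∀ i → ⟦ ℤ.- i ⟧ ≈ - ⟦ i ⟧
    -‿homo (+ zero)  = sym -0#≈0#
    -‿homo (+ suc n) = refl
    -‿homo -[1+ n ]  = sym (-‿involutive _)

    homomorphism : CommutativeRing.rawRing ℤ.+-*-commutativeRing -Raw-AlmostCommutative⟶ fromCommutativeRing R
    homomorphism = record
      { ⟦_⟧ = ⟦_⟧ ; +-homo = +-homo ; *-homo = *-homo ; -‿homo = -‿homo ; 0-homo = refl ; 1-homo = refl }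

    ⟦⟧-≟ : ∀ i j → Maybe (⟦ i ⟧ ≈ ⟦ j ⟧)
    ⟦⟧-≟ i j with i ℤ.≟ j
    ... | yes ≡.refl = just refl
    ... | no _       = nothing

  open import Algebra.Solver.Ring _ _ homomorphism ⟦⟧-≟ public
    using (solve; _:=_; _:+_; _:*_; :-_; _:-_; con)

module ListSums {c ℓ} (R : CommutativeRing c ℓ) where
  open CommutativeRing R
  open import Algebra.Properties.Ring ring using (-0#≈0#; -‿+-comm)
  open import Algebra.Properties.CommutativeSemigroup +-commutativeSemigroup using (interchange)

  Σ Π : List Carrier → Carrier
  Σ = foldr _+_ 0#
  Π = foldr _*_ 1#

  Σ-++ : ∀ xs ys → Σ (xs ++ ys) ≈ Σ xs + Σ ys
  Σ-++ []       ys = sym (+-identityˡ _)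
  Σ-++ (x ∷ xs) ys = trans (+-congˡ (Σ-++ xs ys)) (sym (+-assoc _ _ _))

  Π-++ : ∀ xs ys → Π (xs ++ ys) ≈ Π xs * Π ys
  Π-++ []       ys = sym (*-identityˡ _)
  Π-++ (x ∷ xs) ys = trans (*-congˡ (Π-++ xs ys)) (sym (*-assoc _ _ _))

  module _ {a} {A : Set a} where

    Σ-cong : ∀ {f g : A → Carrier} → (∀ x → f x ≈ g x) → ∀ xs → Σ (map f xs) ≈ Σ (map g xs)
    Σ-cong f≈g []       = refl
    Σ-cong f≈g (x ∷ xs) = +-cong (f≈g x) (Σ-cong f≈g xs)

    Σ-distrib-+ : ∀ (f g : A → Carrier) xs → Σ (map (λ x → f x + g x) xs) ≈ Σ (map f xs) + Σ (map g xs)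
    Σ-distrib-+ f g []       = sym (+-identityˡ _)
    Σ-distrib-+ f g (x ∷ xs) = trans (+-congˡ (Σ-distrib-+ f g xs)) (interchange (f x) (g x) _ _)

    *-distribˡ-Σ : ∀ d (f : A → Carrier) xs → Σ (map (λ x → d * f x) xs) ≈ d * Σ (map f xs)
    *-distribˡ-Σ d f []       = sym (zeroʳ d)
    *-distribˡ-Σ d f (x ∷ xs) = trans (+-congˡ (*-distribˡ-Σ d f xs)) (sym (distribˡ _ _ _))

    Σ-zero : ∀ (f : A → Carrier) → (∀ x → f x ≈ 0#) → ∀ xs → Σ (map f xs) ≈ 0#
    Σ-zero f f≈0 []       = refl
    Σ-zero f f≈0 (x ∷ xs) = trans (+-cong (f≈0 x) (Σ-zero f f≈0 xs)) (+-identityˡ _)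

    Σ-cong-All : ∀ {f g : A → Carrier} {xs} → All (λ x → f x ≈ g x) xs → Σ (map f xs) ≈ Σ (map g xs)
    Σ-cong-All []           = refl
    Σ-cong-All (fx≈gx ∷ eqs) = +-cong fx≈gx (Σ-cong-All eqs)

    Σ-zero-All : ∀ {f : A → Carrier} {xs} → All (λ x → f x ≈ 0#) xs → Σ (map f xs) ≈ 0#
    Σ-zero-All []            = refl
    Σ-zero-All (fx≈0 ∷ eqs) = trans (+-cong fx≈0 (Σ-zero-All eqs)) (+-identityˡ _)

    Σ-neg : ∀ (f : A → Carrier) xs → Σ (map (λ x → - f x) xs) ≈ - Σ (map f xs)
    Σ-neg f []       = sym -0#≈0#
    Σ-neg f (x ∷ xs) = trans (+-congˡ (Σ-neg f xs)) (-‿+-comm _ _)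

    Σ-concatMap : ∀ (f : A → List Carrier) xs → Σ (concatMap f xs) ≈ Σ (map (Σ ∘ f) xs)
    Σ-concatMap f []       = refl
    Σ-concatMap f (x ∷ xs) = trans (Σ-++ (f x) _) (+-congˡ (Σ-concatMap f xs))

    Π-concatMap : ∀ (f : A → List Carrier) xs → Π (concatMap f xs) ≈ Π (map (Π ∘ f) xs)
    Π-concatMap f []       = refl
    Π-concatMap f (x ∷ xs) = trans (Π-++ (f x) _) (*-congˡ (Π-concatMap f xs))

  Σ-comm : ∀ {a b} {A : Set a} {B : Set b} (f : A → B → Carrier) xs ys →
           Σ (map (λ x → Σ (map (f x) ys)) xs) ≈ Σ (map (λ y → Σ (map (λ x → f x y) xs)) ys)
  Σ-comm f []       ys = sym (Σ-zero _ (λ _ → refl) ys)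
  Σ-comm f (x ∷ xs) ys = trans (+-congˡ (Σ-comm f xs ys)) (sym (Σ-distrib-+ (f x) _ ys))

  Σ-upTo-extend : ∀ (t : ℕ → Carrier) {M N} → M ≤ N → (∀ k → M < k → t k ≈ 0#) →
                  Σ (map t (upTo (suc M))) ≈ Σ (map t (upTo (suc N)))
  Σ-upTo-extend t {M} M≤N t≈0 = trans (extendBy (_ ∸ M)) (reflexive (≡.cong Σt (ℕ.m+[n∸m]≡n M≤N)))
    where
    open SetoidReasoning setoid
    Σt : ℕ → Carrier
    Σt N = Σ (map t (upTo (suc N)))
    extendBy : ∀ d → Σt M ≈ Σt (M ℕ.+ d)
    extendBy zero    = reflexive (≡.cong Σt (≡.sym (ℕ.+-identityʳ M)))
    extendBy (suc d) = begin
      Σt M                             ≈⟨ extendBy d ⟩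
      Σt (M ℕ.+ d)                     ≈⟨ +-identityʳ _ ⟨
      Σt (M ℕ.+ d) + 0#                ≈⟨ +-congˡ (t≈0 k (s≤s (ℕ.m≤m+n M d))) ⟨
      Σt (M ℕ.+ d) + t k               ≈⟨ +-congˡ (+-identityʳ _) ⟨
      Σt (M ℕ.+ d) + Σ (t k ∷ [])      ≈⟨ Σ-++ (map t (upTo k)) (t k ∷ []) ⟨
      Σ (map t (upTo k) ++ t k ∷ [])   ≡⟨ ≡.cong Σ (≡.trans (≡.sym (List.map-++ t (upTo k) (k ∷ []))) (≡.cong (map t) (List.upTo-∷ʳ k))) ⟩
      Σt k                             ≡⟨ ≡.cong Σt (ℕ.+-suc M d) ⟨
      Σt (M ℕ.+ suc d)                 ∎
      where
      k : ℕ
      k = suc (M ℕ.+ d)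

module FiniteProducts {c ℓ} (R : CommutativeRing c ℓ) where
  open CommutativeRing R hiding (zero)
  open import Algebra.Properties.Ring ring using (-0#≈0#; -‿+-comm)
  open import Algebra.Properties.CommutativeSemigroup *-commutativeSemigroup using (interchange; x∙yz≈y∙xz)
  open import Algebra.Properties.Semiring.Sum semiring public
    using (sum; ∑-distrib-+; sum-cong-≋; sum-replicate-zero; *-distribˡ-sum)
  open import Algebra.Properties.CommutativeMonoid.Sum *-commutativeMonoid public
    using () renaming (sum to ∏; ∑-distrib-+ to ∏-distrib-*; sum-cong-≋ to ∏-cong; sum-replicate-zero to ∏-replicate-1#)

  ∏≠ : ∀ {n} → Fin n → Vector Carrier n → Carrier
  ∏≠ zero    t = ∏ (t ∘ suc)
  ∏≠ (suc i) t = t zero * ∏≠ i (t ∘ suc)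

  ∏≠-cong : ∀ {n} (i : Fin n) {t u : Vector Carrier n} → (∀ j → t j ≈ u j) → ∏≠ i t ≈ ∏≠ i u
  ∏≠-cong zero    t≈u = ∏-cong (t≈u ∘ suc)
  ∏≠-cong (suc i) t≈u = *-cong (t≈u zero) (∏≠-cong i (t≈u ∘ suc))

  ∏≠-distrib-* : ∀ {n} (i : Fin n) (t u : Vector Carrier n) → ∏≠ i (λ j → t j * u j) ≈ ∏≠ i t * ∏≠ i u
  ∏≠-distrib-* zero    t u = ∏-distrib-* (t ∘ suc) (u ∘ suc)
  ∏≠-distrib-* (suc i) t u = trans (*-congˡ (∏≠-distrib-* i (t ∘ suc) (u ∘ suc))) (interchange _ _ _ _)

  ∏≠-ones : ∀ {n} (i : Fin n) → ∏≠ i (λ _ → 1#) ≈ 1#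
  ∏≠-ones {suc n} zero    = ∏-replicate-1# n
  ∏≠-ones         (suc i) = trans (*-identityˡ _) (∏≠-ones i)

  ∏-split : ∀ {n} (i : Fin n) (t : Vector Carrier n) → ∏ t ≈ t i * ∏≠ i t
  ∏-split zero    t = refl
  ∏-split (suc i) t = trans (*-congˡ (∏-split i (t ∘ suc))) (x∙yz≈y∙xz _ _ _)

  ∑-neg : ∀ {n} (t : Vector Carrier n) → sum (λ i → - t i) ≈ - sum t
  ∑-neg {zero}  t = sym -0#≈0#
  ∑-neg {suc n} t = trans (+-congˡ (∑-neg (t ∘ suc))) (-‿+-comm _ _)

-- Partial fractions

module PartialFractions {c ℓ} (R : CommutativeRing c ℓ) where
  open CommutativeRing R hiding (zero)
  open FiniteProducts R
  open SetoidReasoning setoid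
  open RingSolver R

  module _ {n} (x : Vector Carrier n) where

    Δ : Fin n → Carrier
    Δ a = ∏≠ a (λ b → x a - x b)

    disc : Carrier
    disc = ∏ Δ

    discExcept : Fin n → Carrier
    discExcept i = ∏≠ i Δ

    numer : Carrier → Fin n → Carrier
    numer q i = ∏≠ i (λ j → q * x i - x j)

  -- In the step x = y ∷ x′, besides the hypothesis at (w, s) we use the one at (y, 1), which
  -- evaluates M = ∏ⱼ (q y - x′ⱼ), and termwise the identity
  --   (x′ᵢ - y)(q w - s y) = (q x′ᵢ - y)(w - s y) - (q - 1) y (w - s x′ᵢ).
  partialFractions : ∀ {n} (x : Vector Carrier n) q w s →
    disc x * ∏ (λ i → q * w - s * x i)
      ≈ disc x * ∏ (λ i → w - s * x i)
        + (q - 1#) * w * sum (λ i → numer x q i * discExcept x i * ∏≠ i (λ j → w - s * x j))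
  partialFractions {zero}  x q w s = trans (sym (+-identityʳ _)) (+-congˡ (sym (zeroʳ _)))
  partialFractions {suc n} x q w s = begin
    disc x * (A * Q)                                  ≈⟨ *-congʳ disc-cons ⟩
    V * (U * D′) * (A * Q)
      ≈⟨ solve 6 (λ v u d a p′ q′ → v :* (u :* d) :* (a :* q′) := v :* u :* a :* (d :* q′)) refl V U D′ A P Q ⟩
    V * U * A * (D′ * Q)
      ≈⟨ *-congˡ (partialFractions x′ q w s) ⟩
    V * U * A * (D′ * P + (q - 1#) * w * S′)
      ≈⟨ solve 7 (λ v u d a p′ k s′ → v :* u :* a :* (d :* p′ :+ k :* s′) := v :* (u :* d) :* a :* p′ :+ k :* (v :* u :* a :* s′))
           refl V U D′ A P ((q - 1#) * w) S′ ⟩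
    V * (U * D′) * A * P + (q - 1#) * w * (V * U * A * S′)
      ≈⟨ +-congˡ (*-congˡ tail-identity) ⟩
    V * (U * D′) * A * P + (q - 1#) * w * (Tail - (q - 1#) * y * V * P * W)
      ≈⟨ solve 9 (λ q′ w′ s′ y′ vud v p t w″ →
              vud :* (q′ :* w′ :- s′ :* y′) :* p :+ (q′ :- con (+ 1)) :* w′ :* (t :- (q′ :- con (+ 1)) :* y′ :* v :* p :* w″)
           := vud :* ((w′ :- s′ :* y′) :* p) :+ (q′ :- con (+ 1)) :* w′ :* (vud :* p :+ t :- (q′ :- con (+ 1)) :* y′ :* v :* p :* w″))
           refl q w s y (V * (U * D′)) V P Tail W ⟩
    V * (U * D′) * (B * P) + (q - 1#) * w * (V * (U * D′) * P + Tail - (q - 1#) * y * V * P * W)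
      ≈⟨ +-congˡ (*-congˡ (+-congʳ (+-congʳ (*-congʳ M-identity)))) ⟨
    V * (U * D′) * (B * P) + (q - 1#) * w * ((M * (U * D′) + (q - 1#) * y * V * W) * P + Tail - (q - 1#) * y * V * P * W)
      ≈⟨ +-congˡ (*-congˡ (solve 7 (λ m ud k v w″ p t → (m :* ud :+ k :* v :* w″) :* p :+ t :- k :* v :* p :* w″ := m :* ud :* p :+ t)
           refl M (U * D′) ((q - 1#) * y) V W P Tail)) ⟩
    V * (U * D′) * (B * P) + (q - 1#) * w * (M * (U * D′) * P + Tail)
                                                      ≈⟨ +-cong (*-congʳ disc-cons) (*-congˡ sum-cons) ⟨
    disc x * (B * P) + (q - 1#) * w * sum (λ i → numer x q i * discExcept x i * ∏≠ i (λ j → w - s * x j)) ∎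
    where
    y : Carrier
    y = x zero
    x′ : Vector Carrier n
    x′ = x ∘ suc
    A B P Q D′ V U M : Carrier
    A  = q * w - s * y
    B  = w - s * y
    P  = ∏ (λ i → w - s * x′ i)
    Q  = ∏ (λ i → q * w - s * x′ i)
    D′ = disc x′
    V  = ∏ (λ b → y - x′ b)
    U  = ∏ (λ a → x′ a - y)
    M  = ∏ (λ j → q * y - x′ j)
    Pᵢ Uᵢ Vᵢ : Vector Carrier n
    Pᵢ i = ∏≠ i (λ j → w - s * x′ j)
    Uᵢ i = ∏≠ i (λ a → x′ a - y)
    Vᵢ i = ∏≠ i (λ b → y - x′ b)
    termP termV termU : Vector Carrier n
    termP i = numer x′ q i * discExcept x′ i * Pᵢ i
    termV i = numer x′ q i * discExcept x′ i * Vᵢ i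
    termU i = numer x′ q i * discExcept x′ i * Uᵢ i
    Tail S′ T W : Carrier
    Tail = sum (λ i → (q * x′ i - y) * numer x′ q i * (V * (Uᵢ i * discExcept x′ i)) * (B * Pᵢ i))
    S′   = sum termP
    T    = sum termV
    W    = sum termU

    tail-identity : V * U * A * S′ ≈ Tail - (q - 1#) * y * V * P * W
    tail-identity = begin
      V * U * A * S′
        ≈⟨ *-distribˡ-sum (V * U * A) termP ⟩
      sum (λ i → V * U * A * termP i)
        ≈⟨ sum-cong-≋ termwise ⟩
      sum (λ i → tailᵢ i + - (k * termU i))
        ≈⟨ ∑-distrib-+ tailᵢ (λ i → - (k * termU i)) ⟩
      Tail + sum (λ i → - (k * termU i))
        ≈⟨ +-congˡ (trans (∑-neg (λ i → k * termU i)) (-‿cong (sym (*-distribˡ-sum k termU)))) ⟩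
      Tail - k * W ∎
      where
      k : Carrier
      k = (q - 1#) * y * V * P
      tailᵢ : Vector Carrier n
      tailᵢ i = (q * x′ i - y) * numer x′ q i * (V * (Uᵢ i * discExcept x′ i)) * (B * Pᵢ i)
      termwise : ∀ i → V * U * A * termP i ≈ tailᵢ i - k * termU i
      termwise i = begin
        V * U * A * (N * E * Pᵢ i)
          ≈⟨ *-congʳ (*-congʳ (*-congˡ (∏-split i (λ a → x′ a - y)))) ⟩
        V * ((x′ i - y) * Uᵢ i) * A * (N * E * Pᵢ i)
          ≈⟨ solve 10 (λ v xi y′ u q′ w′ s′ n e p →
               v :* ((xi :- y′) :* u) :* (q′ :* w′ :- s′ :* y′) :* (n :* e :* p)
               := (q′ :* xi :- y′) :* n :* (v :* (u :* e)) :* ((w′ :- s′ :* y′) :* p)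
                  :- (q′ :- con (+ 1)) :* y′ :* v :* ((w′ :- s′ :* xi) :* p) :* (n :* e :* u))
             refl V (x′ i) y (Uᵢ i) q w s N E (Pᵢ i) ⟩
        tailᵢ i - (q - 1#) * y * V * ((w - s * x′ i) * Pᵢ i) * (N * E * Uᵢ i)
          ≈⟨ +-congˡ (-‿cong (*-congʳ (*-congˡ (∏-split i (λ j → w - s * x′ j))))) ⟨
        tailᵢ i - k * (N * E * Uᵢ i) ∎
        where
        N E : Carrier
        N = numer x′ q i
        E = discExcept x′ i

    IH₂ : D′ * M ≈ D′ * V + (q - 1#) * y * T
    IH₂ = begin
      D′ * M
        ≈⟨ *-congˡ (∏-cong (λ i → +-congˡ (-‿cong (*-identityˡ (x′ i))))) ⟨
      D′ * ∏ (λ i → q * y - 1# * x′ i)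
        ≈⟨ partialFractions x′ q y 1# ⟩
      D′ * ∏ (λ i → y - 1# * x′ i) + (q - 1#) * y * sum (λ i → numer x′ q i * discExcept x′ i * ∏≠ i (λ j → y - 1# * x′ j))
        ≈⟨ +-cong (*-congˡ (∏-cong (λ i → +-congˡ (-‿cong (*-identityˡ (x′ i))))))
                  (*-congˡ (sum-cong-≋ (λ i → *-congˡ (∏≠-cong i (λ j → +-congˡ (-‿cong (*-identityˡ (x′ j)))))))) ⟩
      D′ * V + (q - 1#) * y * T ∎

    cancellation : U * T + V * W ≈ 0#
    cancellation = begin
      U * T + V * W
        ≈⟨ +-cong (*-distribˡ-sum U termV) (*-distribˡ-sum V termU) ⟩
      sum (λ i → U * termV i) + sum (λ i → V * termU i)
        ≈⟨ ∑-distrib-+ (λ i → U * termV i) (λ i → V * termU i) ⟨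
      sum (λ i → U * termV i + V * termU i)
        ≈⟨ sum-cong-≋ termwise ⟩
      sum {n} (λ _ → 0#)
        ≈⟨ sum-replicate-zero n ⟩
      0# ∎
      where
      termwise : ∀ i → U * termV i + V * termU i ≈ 0#
      termwise i = trans (+-cong (*-congʳ (∏-split i (λ a → x′ a - y))) (*-congʳ (∏-split i (λ b → y - x′ b))))
        (solve 6 (λ xi y′ u v n e → (xi :- y′) :* u :* (n :* e :* v) :+ (y′ :- xi) :* v :* (n :* e :* u) := con (+ 0))
           refl (x′ i) y (Uᵢ i) (Vᵢ i) (numer x′ q i) (discExcept x′ i))

    M-identity : M * (U * D′) + (q - 1#) * y * V * W ≈ V * (U * D′)
    M-identity = begin
      M * (U * D′) + (q - 1#) * y * V * W
        ≈⟨ +-congʳ (solve 3 (λ m u d → m :* (u :* d) := u :* (d :* m)) refl M U D′) ⟩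
      U * (D′ * M) + (q - 1#) * y * V * W
        ≈⟨ +-congʳ (*-congˡ IH₂) ⟩
      U * (D′ * V + (q - 1#) * y * T) + (q - 1#) * y * V * W
        ≈⟨ solve 6 (λ u d v k t w′ → u :* (d :* v :+ k :* t) :+ k :* v :* w′ := v :* (u :* d) :+ k :* (u :* t :+ v :* w′))
             refl U D′ V ((q - 1#) * y) T W ⟩
      V * (U * D′) + (q - 1#) * y * (U * T + V * W)
        ≈⟨ +-congˡ (trans (*-congˡ cancellation) (zeroʳ _)) ⟩
      V * (U * D′) + 0#
        ≈⟨ +-identityʳ _ ⟩
      V * (U * D′) ∎

    disc-cons : disc x ≈ V * (U * D′)
    disc-cons = *-congˡ (∏-distrib-* (λ a → x′ a - y) (Δ x′))

    sum-cons : sum (λ i → numer x q i * discExcept x i * ∏≠ i (λ j → w - s * x j)) ≈ M * (U * D′) * P + Tail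
    sum-cons = +-cong (*-congʳ (*-congˡ (∏-distrib-* (λ a → x′ a - y) (Δ x′))))
                      (sum-cong-≋ (λ i → *-congʳ (*-congˡ (*-congˡ (∏≠-distrib-* i (λ a → x′ a - y) (Δ x′))))))

module InvertedPartialFractions {c ℓ} (R : CommutativeRing c ℓ) where
  open CommutativeRing R hiding (zero)
  open FiniteProducts R
  open PartialFractions R
  open SetoidReasoning setoid
  open RingSolver R
  open import Algebra.Properties.Semiring.Exp semiring using (_^_)
  open import Algebra.Properties.Monoid.Sum *-monoid using () renaming (sum-replicate to ∏-replicate)

  partialFractions-inverted : ∀ {n} (x : Vector Carrier n) q z (g : Vector Carrier n) →
    (∀ i → (1# - q * z * x i) * g i ≈ 1#) →
    q ^ n * disc x * ∏ (λ i → (1# - z * x i) * g i)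
      ≈ disc x + (q - 1#) * sum (λ i → numer x q i * discExcept x i * g i)
  partialFractions-inverted {n} x q z g g-inverse = begin
    q ^ n * D * ∏ (λ i → a i * g i)
      ≈⟨ *-congˡ (∏-distrib-* a g) ⟩
    q ^ n * D * (∏ a * G)
      ≈⟨ solve 4 (λ qn d pa g′ → qn :* d :* (pa :* g′) := d :* (qn :* pa) :* g′) refl (q ^ n) D (∏ a) G ⟩
    D * (q ^ n * ∏ a) * G
      ≈⟨ *-congʳ (*-congˡ q^n∏a) ⟩
    D * ∏ (λ i → q * 1# - q * z * x i) * G
      ≈⟨ *-congʳ (partialFractions x q 1# (q * z)) ⟩
    (D * ∏ b + (q - 1#) * 1# * sum (λ i → N i * E i * ∏≠ i b)) * G
      ≈⟨ solve 5 (λ d pb k s g′ → (d :* pb :+ k :* con (+ 1) :* s) :* g′ := d :* (pb :* g′) :+ k :* (s :* g′))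
           refl D (∏ b) (q - 1#) (sum (λ i → N i * E i * ∏≠ i b)) G ⟩
    D * (∏ b * G) + (q - 1#) * (sum (λ i → N i * E i * ∏≠ i b) * G)
      ≈⟨ +-cong (trans (*-congˡ ∏b*G≈1) (*-identityʳ D)) (*-congˡ Σ*G) ⟩
    D + (q - 1#) * sum (λ i → N i * E i * g i) ∎
    where
    D G : Carrier
    D = disc x
    G = ∏ g
    a b N E : Vector Carrier n
    a i = 1# - z * x i
    b i = 1# - q * z * x i
    N = numer x q
    E = discExcept x
    q^n∏a : q ^ n * ∏ a ≈ ∏ (λ i → q * 1# - q * z * x i)
    q^n∏a = trans (*-congʳ (sym (∏-replicate n))) (trans (sym (∏-distrib-* (λ _ → q) a))
              (∏-cong (λ i → solve 3 (λ q′ z′ xi → q′ :* (con (+ 1) :- z′ :* xi) := q′ :* con (+ 1) :- q′ :* z′ :* xi) refl q z (x i))))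
    ∏b*G≈1 : ∏ b * G ≈ 1#
    ∏b*G≈1 = trans (sym (∏-distrib-* b g)) (trans (∏-cong g-inverse) (∏-replicate-1# n))
    Σ*G : sum (λ i → N i * E i * ∏≠ i b) * G ≈ sum (λ i → N i * E i * g i)
    Σ*G = trans (*-comm _ G) (trans (*-distribˡ-sum G (λ i → N i * E i * ∏≠ i b)) (sum-cong-≋ λ i → begin
      G * (N i * E i * ∏≠ i b)               ≈⟨ *-congʳ (∏-split i g) ⟩
      g i * ∏≠ i g * (N i * E i * ∏≠ i b)    ≈⟨ solve 5 (λ gi pg n e pb → gi :* pg :* (n :* e :* pb) := n :* e :* gi :* (pb :* pg))
                                                  refl (g i) (∏≠ i g) (N i) (E i) (∏≠ i b) ⟩
      N i * E i * g i * (∏≠ i b * ∏≠ i g)    ≈⟨ *-congˡ (trans (sym (∏≠-distrib-* i b g))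
                                                                (trans (∏≠-cong i g-inverse) (∏≠-ones i))) ⟩
      N i * E i * g i * 1#                   ≈⟨ *-identityʳ _ ⟩
      N i * E i * g i                        ∎))

module HomomorphicImages {c₁ ℓ₁ c₂ ℓ₂} (R₁ : CommutativeRing c₁ ℓ₁) (R₂ : CommutativeRing c₂ ℓ₂)
  {h : CommutativeRing.Carrier R₁ → CommutativeRing.Carrier R₂}
  (h-isRingHomomorphism : IsRingHomomorphism (CommutativeRing.rawRing R₁) (CommutativeRing.rawRing R₂) h) where
  private
    module A where
      open CommutativeRing R₁ public
      open import Algebra.Properties.Semiring.Exp semiring public using (_^_)
    module B where
      open CommutativeRing R₂ public
      open import Algebra.Properties.Semiring.Exp semiring public using (_^_)
    module ∏A = FiniteProducts R₁
    module ∏B = FiniteProducts R₂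
    module PA = PartialFractions R₁
    module PB = PartialFractions R₂
  open IsRingHomomorphism h-isRingHomomorphism public

  h-minus : ∀ a b → h (a A.- b) B.≈ h a B.- h b
  h-minus a b = B.trans (+-homo a (A.- b)) (B.+-congˡ (-‿homo b))

  h-∏ : ∀ {n} (t : Vector A.Carrier n) → h (∏A.∏ t) B.≈ ∏B.∏ (h ∘ t)
  h-∏ {zero}  t = 1#-homo
  h-∏ {suc n} t = B.trans (*-homo _ _) (B.*-congˡ (h-∏ (t ∘ suc)))

  h-∏≠ : ∀ {n} (i : Fin n) (t : Vector A.Carrier n) → h (∏A.∏≠ i t) B.≈ ∏B.∏≠ i (h ∘ t)
  h-∏≠ zero    t = h-∏ (t ∘ suc)
  h-∏≠ (suc i) t = B.trans (*-homo _ _) (B.*-congˡ (h-∏≠ i (t ∘ suc)))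

  h-Δ : ∀ {n} (x : Vector A.Carrier n) a → h (PA.Δ x a) B.≈ PB.Δ (h ∘ x) a
  h-Δ x a = B.trans (h-∏≠ a _) (∏B.∏≠-cong a (λ b → h-minus (x a) (x b)))

  h-disc : ∀ {n} (x : Vector A.Carrier n) → h (PA.disc x) B.≈ PB.disc (h ∘ x)
  h-disc x = B.trans (h-∏ (PA.Δ x)) (∏B.∏-cong (h-Δ x))

  h-discExcept : ∀ {n} (x : Vector A.Carrier n) i → h (PA.discExcept x i) B.≈ PB.discExcept (h ∘ x) i
  h-discExcept x i = B.trans (h-∏≠ i (PA.Δ x)) (∏B.∏≠-cong i (h-Δ x))

  h-numer : ∀ {n} (x : Vector A.Carrier n) q i → h (PA.numer x q i) B.≈ PB.numer (h ∘ x) (h q) i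
  h-numer x q i = B.trans (h-∏≠ i _) (∏B.∏≠-cong i (λ j → B.trans (h-minus _ _) (B.+-congʳ (*-homo q (x i)))))

  h-^ : ∀ x n → h (x A.^ n) B.≈ h x B.^ n
  h-^ x zero    = 1#-homo
  h-^ x (suc n) = B.trans (*-homo x (x A.^ n)) (B.*-congˡ (h-^ x n))

-- Power series in one variable

module PowerSeries {c ℓ} (R : CommutativeRing c ℓ) where
  open CommutativeRing R
  open ListSums R
  open SetoidReasoning setoid
  open import Algebra.Properties.Ring ring using (-0#≈0#; -‿distribˡ-*)

  Series : Set c
  Series = ℕ → Carrier

  infix 4 _≋_
  record _≋_ (f g : Series) : Set ℓ where
    constructor coeffwise
    field coeff : ∀ m → f m ≈ g m
  open _≋_ public

  infixl 6 _⊕_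
  infixl 7 _⊛_
  infix  8 ⊖_

  _⊕_ : Series → Series → Series
  (f ⊕ g) m = f m + g m

  ⊖_ : Series → Series
  (⊖ f) m = - f m

  _⊛_ : Series → Series → Series
  (f ⊛ g) m = Σ (map (λ k → f k * g (m ∸ k)) (upTo (suc m)))

  const : Carrier → Series
  const a zero    = a
  const a (suc _) = 0#

  𝟘 𝟙 : Series
  𝟘 _ = 0#
  𝟙 = const 1#

  shift : Series → Series
  shift f = f ∘ suc

  ⊛-zero : ∀ f g → (f ⊛ g) 0 ≈ f 0 * g 0
  ⊛-zero f g = +-identityʳ _

  ⊛-suc : ∀ f g m → (f ⊛ g) (suc m) ≈ f 0 * g (suc m) + (shift f ⊛ g) m
  ⊛-suc f g m = +-congˡ (reflexive (≡.cong Σ (≡.trans (List.map-applyUpTo suc _ (suc m))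
                  (≡.sym (List.map-applyUpTo id _ (suc m))))))

  ⊛-cong : ∀ {f f′ g g′} → (∀ m → f m ≈ f′ m) → (∀ m → g m ≈ g′ m) → ∀ m → (f ⊛ g) m ≈ (f′ ⊛ g′) m
  ⊛-cong f≈f′ g≈g′ m = Σ-cong (λ k → *-cong (f≈f′ k) (g≈g′ (m ∸ k))) (upTo (suc m))

  ⊛-distribˡ : ∀ f g h m → (f ⊛ (g ⊕ h)) m ≈ (f ⊛ g) m + (f ⊛ h) m
  ⊛-distribˡ f g h m = trans (Σ-cong (λ k → distribˡ (f k) _ _) (upTo (suc m))) (Σ-distrib-+ _ _ (upTo (suc m)))

  ⊛-distribʳ : ∀ f g h m → ((g ⊕ h) ⊛ f) m ≈ (g ⊛ f) m + (h ⊛ f) m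
  ⊛-distribʳ f g h m = trans (Σ-cong (λ k → distribʳ (f (m ∸ k)) _ _) (upTo (suc m))) (Σ-distrib-+ _ _ (upTo (suc m)))

  ⊛-neg : ∀ f g m → ((⊖ f) ⊛ g) m ≈ - (f ⊛ g) m
  ⊛-neg f g m = trans (Σ-cong (λ k → sym (-‿distribˡ-* (f k) _)) (upTo (suc m))) (Σ-neg _ (upTo (suc m)))

  ⊛-scaleˡ : ∀ a f g m → ((λ k → a * f k) ⊛ g) m ≈ a * (f ⊛ g) m
  ⊛-scaleˡ a f g m = trans (Σ-cong (λ k → *-assoc a (f k) _) (upTo (suc m))) (*-distribˡ-Σ a _ (upTo (suc m)))

  ⊛-zeroˡ : ∀ g m → (𝟘 ⊛ g) m ≈ 0#
  ⊛-zeroˡ g m = Σ-zero _ (λ k → zeroˡ (g (m ∸ k))) (upTo (suc m))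

  const-⊛ : ∀ a g m → (const a ⊛ g) m ≈ a * g m
  const-⊛ a g zero    = ⊛-zero (const a) g
  const-⊛ a g (suc m) = trans (⊛-suc (const a) g m) (trans (+-congˡ (⊛-zeroˡ g m)) (+-identityʳ _))

  ⊛-identityˡ : ∀ g m → (𝟙 ⊛ g) m ≈ g m
  ⊛-identityˡ g m = trans (const-⊛ 1# g m) (*-identityˡ _)

  ⊛-assoc : ∀ f g h m → ((f ⊛ g) ⊛ h) m ≈ (f ⊛ (g ⊛ h)) m
  ⊛-assoc f g h zero = begin
    ((f ⊛ g) ⊛ h) 0    ≈⟨ trans (⊛-zero (f ⊛ g) h) (*-congʳ (⊛-zero f g)) ⟩
    f 0 * g 0 * h 0    ≈⟨ *-assoc _ _ _ ⟩
    f 0 * (g 0 * h 0)  ≈⟨ trans (⊛-zero f (g ⊛ h)) (*-congˡ (⊛-zero g h)) ⟨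
    (f ⊛ (g ⊛ h)) 0    ∎
  ⊛-assoc f g h (suc m) = begin
    ((f ⊛ g) ⊛ h) (suc m)
      ≈⟨ ⊛-suc (f ⊛ g) h m ⟩
    (f ⊛ g) 0 * h (suc m) + (shift (f ⊛ g) ⊛ h) m
      ≈⟨ +-cong (*-congʳ (⊛-zero f g))
                (⊛-cong {f′ = (λ k → f 0 * shift g k) ⊕ (shift f ⊛ g)} {g = h} {g′ = h} (⊛-suc f g) (λ _ → refl) m) ⟩
    f 0 * g 0 * h (suc m) + (((λ k → f 0 * shift g k) ⊕ (shift f ⊛ g)) ⊛ h) m
      ≈⟨ +-congˡ (trans (⊛-distribʳ h _ _ m) (+-cong (⊛-scaleˡ (f 0) (shift g) h m) (⊛-assoc (shift f) g h m))) ⟩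
    f 0 * g 0 * h (suc m) + (f 0 * (shift g ⊛ h) m + (shift f ⊛ (g ⊛ h)) m)
      ≈⟨ regroup (f 0) (g 0) (h (suc m)) _ _ ⟩
    f 0 * (g 0 * h (suc m) + (shift g ⊛ h) m) + (shift f ⊛ (g ⊛ h)) m
      ≈⟨ +-congʳ (*-congˡ (⊛-suc g h m)) ⟨
    f 0 * (g ⊛ h) (suc m) + (shift f ⊛ (g ⊛ h)) m
      ≈⟨ ⊛-suc f (g ⊛ h) m ⟨
    (f ⊛ (g ⊛ h)) (suc m) ∎
    where
    open RingSolver R
    regroup : ∀ a b d u v → a * b * d + (a * u + v) ≈ a * (b * d + u) + v
    regroup = solve 5 (λ a b d u v → a :* b :* d :+ (a :* u :+ v) := a :* (b :* d :+ u) :+ v) refl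

  ⊛-comm : ∀ f g m → (f ⊛ g) m ≈ (g ⊛ f) m
  ⊛-comm f g zero = trans (⊛-zero f g) (trans (*-comm _ _) (sym (⊛-zero g f)))
  ⊛-comm f g (suc zero) = begin
    (f ⊛ g) 1                 ≈⟨ trans (⊛-suc f g 0) (+-congˡ (⊛-zero (shift f) g)) ⟩
    f 0 * g 1 + f 1 * g 0     ≈⟨ +-comm _ _ ⟩
    f 1 * g 0 + f 0 * g 1     ≈⟨ +-cong (*-comm _ _) (*-comm _ _) ⟩
    g 0 * f 1 + g 1 * f 0     ≈⟨ trans (⊛-suc g f 0) (+-congˡ (⊛-zero (shift g) f)) ⟨
    (g ⊛ f) 1                 ∎
  ⊛-comm f g (suc (suc m)) = begin
    (f ⊛ g) (suc (suc m))
      ≈⟨ trans (⊛-suc f g (suc m)) (+-congˡ (⊛-comm (shift f) g (suc m))) ⟩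
    f 0 * g (suc (suc m)) + (g ⊛ shift f) (suc m)
      ≈⟨ +-congˡ (trans (⊛-suc g (shift f) m) (+-congˡ (⊛-comm (shift g) (shift f) m))) ⟩
    f 0 * g (suc (suc m)) + (g 0 * f (suc (suc m)) + (shift f ⊛ shift g) m)
      ≈⟨ x∙yz≈y∙xz _ _ _ ⟩
    g 0 * f (suc (suc m)) + (f 0 * g (suc (suc m)) + (shift f ⊛ shift g) m)
      ≈⟨ +-congˡ (⊛-suc f (shift g) m) ⟨
    g 0 * f (suc (suc m)) + (f ⊛ shift g) (suc m)
      ≈⟨ trans (⊛-suc g f (suc m)) (+-congˡ (⊛-comm (shift g) f (suc m))) ⟨
    (g ⊛ f) (suc (suc m)) ∎
    where open import Algebra.Properties.CommutativeSemigroup +-commutativeSemigroup using (x∙yz≈y∙xz)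

  ≋-isEquivalence : IsEquivalence _≋_
  ≋-isEquivalence = record
    { refl  = coeffwise (λ _ → refl)
    ; sym   = λ f≋g → coeffwise (λ m → sym (coeff f≋g m))
    ; trans = λ f≋g g≋h → coeffwise (λ m → trans (coeff f≋g m) (coeff g≋h m))
    }

  series-isCommutativeRing : IsCommutativeRing _≋_ _⊕_ _⊛_ ⊖_ 𝟘 𝟙
  series-isCommutativeRing = record
    { isRing = record
      { +-isAbelianGroup = record
        { isGroup = record
          { isMonoid = record
            { isSemigroup = record
              { isMagma = record
                { isEquivalence = ≋-isEquivalence
                ; ∙-cong = λ f≋f′ g≋g′ → coeffwise (λ m → +-cong (coeff f≋f′ m) (coeff g≋g′ m))
                }
              ; assoc = λ f g h → coeffwise (λ m → +-assoc (f m) (g m) (h m))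
              }
            ; identity = (λ f → coeffwise (λ m → +-identityˡ (f m))) , (λ f → coeffwise (λ m → +-identityʳ (f m)))
            }
          ; inverse = (λ f → coeffwise (λ m → -‿inverseˡ (f m))) , (λ f → coeffwise (λ m → -‿inverseʳ (f m)))
          ; ⁻¹-cong = λ f≋g → coeffwise (λ m → -‿cong (coeff f≋g m))
          }
        ; comm = λ f g → coeffwise (λ m → +-comm (f m) (g m))
        }
      ; *-cong = λ f≋f′ g≋g′ → coeffwise (⊛-cong (coeff f≋f′) (coeff g≋g′))
      ; *-assoc = λ f g h → coeffwise (⊛-assoc f g h)
      ; *-identity = (λ g → coeffwise (⊛-identityˡ g)) , (λ g → coeffwise (λ m → trans (⊛-comm g 𝟙 m) (⊛-identityˡ g m)))
      ; distrib = (λ f g h → coeffwise (⊛-distribˡ f g h)) , (λ f g h → coeffwise (⊛-distribʳ f g h))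
      }
    ; *-comm = λ f g → coeffwise (⊛-comm f g)
    }

  seriesRing : CommutativeRing c ℓ
  seriesRing = record { isCommutativeRing = series-isCommutativeRing }

  const-isRingHomomorphism : IsRingHomomorphism rawRing (CommutativeRing.rawRing seriesRing) const
  const-isRingHomomorphism = record
    { isSemiringHomomorphism = record
      { isNearSemiringHomomorphism = record
        { +-isMonoidHomomorphism = record
          { isMagmaHomomorphism = record
            { isRelHomomorphism = record { cong = λ a≈b → coeffwise λ { zero → a≈b ; (suc m) → refl } }
            ; homo = λ a b → coeffwise λ { zero → refl ; (suc m) → sym (+-identityˡ 0#) }
            }
          ; ε-homo = coeffwise λ { zero → refl ; (suc m) → refl }
          }
        ; *-homo = λ a b → coeffwise λ m → sym (trans (const-⊛ a (const b) m) (const-* m))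
        }
      ; 1#-homo = coeffwise λ { zero → refl ; (suc m) → refl }
      }
    ; -‿homo = λ a → coeffwise λ { zero → refl ; (suc m) → sym -0#≈0# }
    }
    where
    const-* : ∀ {a b} m → a * const b m ≈ const (a * b) m
    const-* zero    = refl
    const-* (suc m) = zeroʳ _

  z : Series
  z (suc zero) = 1#
  z _          = 0#

  z-⊛-zero : ∀ g → (z ⊛ g) 0 ≈ 0#
  z-⊛-zero g = trans (⊛-zero z g) (zeroˡ _)

  z-⊛-suc : ∀ g m → (z ⊛ g) (suc m) ≈ g m
  z-⊛-suc g m = begin
    (z ⊛ g) (suc m)                   ≈⟨ ⊛-suc z g m ⟩
    0# * g (suc m) + (shift z ⊛ g) m  ≈⟨ +-cong (zeroˡ _) (⊛-cong {g = g} {g′ = g} shift-z (λ _ → refl) m) ⟩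
    0# + (𝟙 ⊛ g) m                    ≈⟨ trans (+-identityˡ _) (⊛-identityˡ g m) ⟩
    g m                               ∎
    where
    shift-z : ∀ k → shift z k ≈ 𝟙 k
    shift-z zero    = refl
    shift-z (suc k) = refl

  geometric-inverse : ∀ r g → g 0 ≈ 1# → (∀ m → g (suc m) ≈ r * g m) → (𝟙 ⊕ ⊖ (const r ⊛ z)) ⊛ g ≋ 𝟙
  geometric-inverse r g g₀≈1 g-rec = coeffwise coefficient
    where
    rz-⊛ : ∀ m → ((const r ⊛ z) ⊛ g) m ≈ r * (z ⊛ g) m
    rz-⊛ m = trans (⊛-assoc (const r) z g m) (const-⊛ r (z ⊛ g) m)
    expand : ∀ m → ((𝟙 ⊕ ⊖ (const r ⊛ z)) ⊛ g) m ≈ g m - r * (z ⊛ g) m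
    expand m = trans (⊛-distribʳ g 𝟙 (⊖ (const r ⊛ z)) m)
                     (+-cong (⊛-identityˡ g m) (trans (⊛-neg (const r ⊛ z) g m) (-‿cong (rz-⊛ m))))
    coefficient : ∀ m → ((𝟙 ⊕ ⊖ (const r ⊛ z)) ⊛ g) m ≈ 𝟙 m
    coefficient zero = begin
      ((𝟙 ⊕ ⊖ (const r ⊛ z)) ⊛ g) 0  ≈⟨ expand 0 ⟩
      g 0 - r * (z ⊛ g) 0            ≈⟨ +-cong g₀≈1 (-‿cong (trans (*-congˡ (z-⊛-zero g)) (zeroʳ r))) ⟩
      1# - 0#                        ≈⟨ trans (+-congˡ -0#≈0#) (+-identityʳ 1#) ⟩
      1#                             ∎
    coefficient (suc m) = begin
      ((𝟙 ⊕ ⊖ (const r ⊛ z)) ⊛ g) (suc m)  ≈⟨ expand (suc m) ⟩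
      g (suc m) - r * (z ⊛ g) (suc m)      ≈⟨ +-cong (g-rec m) (-‿cong (*-congˡ (z-⊛-suc g m))) ⟩
      r * g m - r * g m                    ≈⟨ -‿inverseʳ _ ⟩
      0#                                   ∎

module _ {a c ℓ ℓ₁} {A : Set a} (_≈₁_ : Rel A ℓ₁) (_+₁_ _*₁_ : A → A → A) (-₁_ : A → A) (0₁ 1₁ : A)
         (B : CommutativeRing c ℓ) (h : A → CommutativeRing.Carrier B) where
  private module B = CommutativeRing B

  isCommutativeRing-viaEmbedding :
    (∀ {x y} → x ≈₁ y → h x B.≈ h y) → (∀ {x y} → h x B.≈ h y → x ≈₁ y) →
    (∀ x y → h (x +₁ y) B.≈ h x B.+ h y) → (∀ x y → h (x *₁ y) B.≈ h x B.* h y) →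
    (∀ x → h (-₁ x) B.≈ B.- h x) → h 0₁ B.≈ B.0# → h 1₁ B.≈ B.1# →
    IsCommutativeRing _≈₁_ _+₁_ _*₁_ -₁_ 0₁ 1₁
  isCommutativeRing-viaEmbedding cong injective +-homo *-homo -‿homo 0-homo 1-homo =
    RingMonomorphism.isCommutativeRing monomorphism B.isCommutativeRing
    where
    rawRing : RawRing a ℓ₁
    rawRing = record { Carrier = A ; _≈_ = _≈₁_ ; _+_ = _+₁_ ; _*_ = _*₁_ ; -_ = -₁_ ; 0# = 0₁ ; 1# = 1₁ }
    monomorphism : IsRingMonomorphism rawRing B.rawRing h
    monomorphism = record
      { isRingHomomorphism = record
        { isSemiringHomomorphism = record
          { isNearSemiringHomomorphism = record
            { +-isMonoidHomomorphism = record
              { isMagmaHomomorphism = record { isRelHomomorphism = record { cong = cong } ; homo = +-homo }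
              ; ε-homo = 0-homo
              }
            ; *-homo = *-homo
            }
          ; 1#-homo = 1-homo
          }
        ; -‿homo = -‿homo
        }
      ; injective = injective
      }

-- ℤ[q] and ℚ(q)

module ℤ[[t]] = PowerSeries ℤ.+-*-commutativeRing

coeffP-addP : ∀ p r k → coeffP (addP p r) k ≡ coeffP p k ℤ.+ coeffP r k
coeffP-addP []      r       k       = ≡.sym (ℤ.+-identityˡ _)
coeffP-addP (a ∷ p) []      k       = ≡.sym (ℤ.+-identityʳ _)
coeffP-addP (a ∷ p) (b ∷ r) zero    = ≡.refl
coeffP-addP (a ∷ p) (b ∷ r) (suc k) = coeffP-addP p r k

coeffP-negP : ∀ p k → coeffP (negP p) k ≡ ℤ.- coeffP p k
coeffP-negP []      k       = ≡.refl
coeffP-negP (a ∷ p) zero    = ≡.refl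
coeffP-negP (a ∷ p) (suc k) = coeffP-negP p k

coeffP-scale : ∀ a r k → coeffP (map (a ℤ.*_) r) k ≡ a ℤ.* coeffP r k
coeffP-scale a []      k       = ≡.sym (ℤ.*-zeroʳ a)
coeffP-scale a (b ∷ r) zero    = ≡.refl
coeffP-scale a (b ∷ r) (suc k) = coeffP-scale a r k

coeffP-mulP-suc : ∀ a p r k → coeffP (mulP (a ∷ p) r) (suc k) ≡ a ℤ.* coeffP r (suc k) ℤ.+ coeffP (mulP p r) k
coeffP-mulP-suc a p r k = ≡.trans (coeffP-addP (map (a ℤ.*_) r) _ (suc k)) (≡.cong (ℤ._+ _) (coeffP-scale a r (suc k)))

coeffP-mulP : ∀ p r k → coeffP (mulP p r) k ≡ (coeffP p ℤ[[t]].⊛ coeffP r) k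
coeffP-mulP []      r k       = ≡.sym (ℤ[[t]].⊛-zeroˡ (coeffP r) k)
coeffP-mulP (a ∷ p) r zero    = ≡.trans (coeffP-addP (map (a ℤ.*_) r) _ 0) (≡.cong (ℤ._+ + 0) (coeffP-scale a r 0))
coeffP-mulP (a ∷ p) r (suc k) = ≡.trans (coeffP-mulP-suc a p r k)
  (≡.trans (≡.cong (λ x → a ℤ.* coeffP r (suc k) ℤ.+ x) (coeffP-mulP p r k)) (≡.sym (ℤ[[t]].⊛-suc (coeffP (a ∷ p)) (coeffP r) k)))

infix 4 _≈ₚ_
record _≈ₚ_ (p r : Poly) : Set where
  constructor ≈P⇒≈ₚ
  field ≈ₚ⇒≈P : p ≈P r
open _≈ₚ_

poly-isCommutativeRing : IsCommutativeRing _≈ₚ_ addP mulP negP [] (+ 1 ∷ [])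
poly-isCommutativeRing = isCommutativeRing-viaEmbedding _≈ₚ_ addP mulP negP [] (+ 1 ∷ []) ℤ[[t]].seriesRing coeffP
  (λ p≈r → ℤ[[t]].coeffwise (≈ₚ⇒≈P p≈r)) (λ p≈r → ≈P⇒≈ₚ (ℤ[[t]].coeff p≈r))
  (λ p r → ℤ[[t]].coeffwise (coeffP-addP p r)) (λ p r → ℤ[[t]].coeffwise (coeffP-mulP p r))
  (λ p → ℤ[[t]].coeffwise (coeffP-negP p)) (ℤ[[t]].coeffwise (λ _ → ≡.refl))
  (ℤ[[t]].coeffwise λ { zero → ≡.refl ; (suc k) → ≡.refl })

polyRing : CommutativeRing _ _
polyRing = record { isCommutativeRing = poly-isCommutativeRing }

module ℤ[q] = CommutativeRing polyRing

cons-zero : ∀ {p} → p ≈P [] → (+ 0 ∷ p) ≈P []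
cons-zero p≈0 zero    = ≡.refl
cons-zero p≈0 (suc k) = p≈0 k

mulP-dropZeroˡ : ∀ p r → mulP (+ 0 ∷ p) r ≈P [] → mulP p r ≈P []
mulP-dropZeroˡ p r pr≈0 k = ≡.trans (≡.sym (≡.trans (coeffP-mulP-suc (+ 0) p r k) (ℤ.+-identityˡ _))) (pr≈0 (suc k))

mulP-comm : ∀ p r → mulP p r ≈P mulP r p
mulP-comm p r = ≈ₚ⇒≈P (ℤ[q].*-comm p r)

mulP-dropZeroʳ : ∀ p r → mulP p (+ 0 ∷ r) ≈P [] → mulP p r ≈P []
mulP-dropZeroʳ p r pr≈0 k =
  ≡.trans (mulP-comm p r k) (mulP-dropZeroˡ r p (λ k → ≡.trans (mulP-comm (+ 0 ∷ r) p k) (pr≈0 k)) k)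

coeffP-mulP-zero : ∀ a p b r → coeffP (mulP (a ∷ p) (b ∷ r)) 0 ≡ a ℤ.* b
coeffP-mulP-zero a p b r = ≡.trans (coeffP-addP (map (a ℤ.*_) (b ∷ r)) (+ 0 ∷ mulP p (b ∷ r)) 0) (ℤ.+-identityʳ (a ℤ.* b))

mulP-headNonZero⇒zero : ∀ {a} p r → ¬ a ≡ + 0 → mulP (a ∷ p) r ≈P [] → r ≈P []
mulP-headNonZero⇒zero     p []      a≢0 _    = λ _ → ≡.refl
mulP-headNonZero⇒zero {a} p (b ∷ r) a≢0 pr≈0 with ℤ.i*j≡0⇒i≡0∨j≡0 a (≡.trans (≡.sym (coeffP-mulP-zero a p b r)) (pr≈0 0))
... | inj₁ a≡0    = ⊥-elim (a≢0 a≡0)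
... | inj₂ ≡.refl = cons-zero (mulP-headNonZero⇒zero p r a≢0 (mulP-dropZeroʳ (a ∷ p) r pr≈0))

mulP-zero⇒zero : ∀ p r → mulP p r ≈P [] → p ≈P [] ⊎ r ≈P []
mulP-zero⇒zero []      r _    = inj₁ (λ _ → ≡.refl)
mulP-zero⇒zero (a ∷ p) r pr≈0 with a ℤ.≟ + 0
... | yes ≡.refl = Sum.map₁ cons-zero (mulP-zero⇒zero p r (mulP-dropZeroˡ p r pr≈0))
... | no a≢0   = inj₂ (mulP-headNonZero⇒zero p r a≢0 pr≈0)

mulP-nonZero : ∀ p r → ¬ p ≈P [] → ¬ r ≈P [] → ¬ mulP p r ≈P []
mulP-nonZero p r p≉0 r≉0 pr≈0 = Sum.[ p≉0 , r≉0 ] (mulP-zero⇒zero p r pr≈0)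

mulP-cancelʳ : ∀ x y d → ¬ d ≈P [] → mulP x d ≈ₚ mulP y d → x ≈ₚ y
mulP-cancelʳ x y d d≉0 xd≈yd = x∙y⁻¹≈ε⇒x≈y x y (≈P⇒≈ₚ (Sum.[ id , ⊥-elim ∘ d≉0 ]
  (mulP-zero⇒zero (addP x (negP y)) d (≈ₚ⇒≈P (ℤ[q].trans ([y-z]x≈yx-zx d x y) (x≈y⇒x∙y⁻¹≈ε xd≈yd))))))
  where open import Algebra.Properties.Ring ℤ[q].ring using ([y-z]x≈yx-zx; x≈y⇒x∙y⁻¹≈ε; x∙y⁻¹≈ε⇒x≈y)

-- No η, and operations defined by matching on frac: otherwise x +ᶠ y would unfold for variables and
-- unification would have to invert addP/mulP, so implicit arguments of ring lemmas could not be inferred.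
record Frac : Set where
  no-eta-equality
  pattern
  constructor frac
  field
    val   : K
    den≉0 : NonZeroDen val
open Frac public

infix 4 _≈ᶠ_
record _≈ᶠ_ (x y : Frac) : Set where
  constructor ≈K⇒≈ᶠ
  field ≈ᶠ⇒≈K : val x ≈K val y
open _≈ᶠ_ public

infixl 6 _+ᶠ_
infixl 7 _*ᶠ_
infix  8 -ᶠ_

_+ᶠ_ _*ᶠ_ : Frac → Frac → Frac
frac x x≉0 +ᶠ frac y y≉0 = frac (x +K y) (mulP-nonZero (den x) (den y) x≉0 y≉0)
frac x x≉0 *ᶠ frac y y≉0 = frac (x *K y) (mulP-nonZero (den x) (den y) x≉0 y≉0)

-ᶠ_ : Frac → Frac
-ᶠ frac x x≉0 = frac (-K x) x≉0

one≉0 : ¬ (+ 1 ∷ []) ≈P []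
one≉0 1≈0 with 1≈0 0
... | ()

0ᶠ 1ᶠ qᶠ : Frac
0ᶠ = frac 0K one≉0
1ᶠ = frac 1K one≉0
qᶠ = frac qK one≉0

module _ where
  open RingSolver polyRing
  open ℤ[q] using (_+_; _*_; -_)
  open import Algebra.Definitions _≈ᶠ_
  open import Algebra.Properties.Ring ℤ[q].ring using (-‿distribˡ-*)
  open import Algebra.Properties.CommutativeSemigroup ℤ[q].*-commutativeSemigroup using (interchange)

  private
    n d : Frac → Poly
    n x = num (val x)
    d x = den (val x)

    by-cross : ∀ {x y} → n x * d y ≈ₚ n y * d x → x ≈ᶠ y
    by-cross e = ≈K⇒≈ᶠ (≈ₚ⇒≈P e)

    cross : ∀ {x y} → x ≈ᶠ y → n x * d y ≈ₚ n y * d x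
    cross e = ≈P⇒≈ₚ (≈ᶠ⇒≈K e)

  ≈ᶠ-isEquivalence : IsEquivalence _≈ᶠ_
  ≈ᶠ-isEquivalence = record
    { refl  = by-cross ℤ[q].refl
    ; sym   = λ x≈y → by-cross (ℤ[q].sym (cross x≈y))
    ; trans = λ {x} {y} {z} x≈y y≈z → by-cross (mulP-cancelʳ (n x * d z) (n z * d x) (d y) (den≉0 y) (begin
        n x * d z * d y  ≈⟨ swap (n x) (d z) (d y) ⟩
        n x * d y * d z  ≈⟨ ℤ[q].*-congʳ (cross x≈y) ⟩
        n y * d x * d z  ≈⟨ swap (n y) (d x) (d z) ⟩
        n y * d z * d x  ≈⟨ ℤ[q].*-congʳ (cross y≈z) ⟩
        n z * d y * d x  ≈⟨ swap (n z) (d y) (d x) ⟩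
        n z * d x * d y  ∎))
    }
    where
    open SetoidReasoning ℤ[q].setoid
    swap : ∀ a b c → a * b * c ≈ₚ a * c * b
    swap = solve 3 (λ a b c → a :* b :* c := a :* c :* b) ℤ[q].refl

  ≈ᶠ-setoid : Setoid _ _
  ≈ᶠ-setoid = record { isEquivalence = ≈ᶠ-isEquivalence }

  +ᶠ-cong : Congruent₂ _+ᶠ_
  +ᶠ-cong {x@(frac _ _)} {x′@(frac _ _)} {y@(frac _ _)} {y′@(frac _ _)} x≈x′ y≈y′ = by-cross (ℤ[q].trans
    (solve 6 (λ nx dy ny dx dx′ dy′ → (nx :* dy :+ ny :* dx) :* (dx′ :* dy′)
               := nx :* dx′ :* (dy :* dy′) :+ ny :* dy′ :* (dx :* dx′)) ℤ[q].refl (n x) (d y) (n y) (d x) (d x′) (d y′))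
    (ℤ[q].trans (ℤ[q].+-cong (ℤ[q].*-congʳ (cross x≈x′)) (ℤ[q].*-congʳ (cross y≈y′)))
    (solve 6 (λ nx′ dy ny′ dx dx′ dy′ → nx′ :* dx :* (dy :* dy′) :+ ny′ :* dy :* (dx :* dx′)
               := (nx′ :* dy′ :+ ny′ :* dx′) :* (dx :* dy)) ℤ[q].refl (n x′) (d y) (n y′) (d x) (d x′) (d y′))))

  *ᶠ-cong : Congruent₂ _*ᶠ_
  *ᶠ-cong {x@(frac _ _)} {x′@(frac _ _)} {y@(frac _ _)} {y′@(frac _ _)} x≈x′ y≈y′ = by-cross (ℤ[q].trans
    (interchange (n x) (n y) (d x′) (d y′))
    (ℤ[q].trans (ℤ[q].*-cong (cross x≈x′) (cross y≈y′)) (interchange (n x′) (d x) (n y′) (d y))))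

  -ᶠ-cong : Congruent₁ -ᶠ_
  -ᶠ-cong {x@(frac _ _)} {x′@(frac _ _)} x≈x′ = by-cross (ℤ[q].trans (ℤ[q].sym (-‿distribˡ-* (n x) (d x′)))
    (ℤ[q].trans (ℤ[q].-‿cong (cross x≈x′)) (-‿distribˡ-* (n x′) (d x))))

  +ᶠ-assoc : Associative _+ᶠ_
  +ᶠ-assoc x@(frac _ _) y@(frac _ _) z@(frac _ _) = by-cross (solve 6 (λ nx dx ny dy nz dz →
    ((nx :* dy :+ ny :* dx) :* dz :+ nz :* (dx :* dy)) :* (dx :* (dy :* dz))
    := (nx :* (dy :* dz) :+ (ny :* dz :+ nz :* dy) :* dx) :* ((dx :* dy) :* dz)) ℤ[q].refl (n x) (d x) (n y) (d y) (n z) (d z))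

  +ᶠ-comm : Commutative _+ᶠ_
  +ᶠ-comm x@(frac _ _) y@(frac _ _) = by-cross (solve 4 (λ nx dx ny dy →
    (nx :* dy :+ ny :* dx) :* (dy :* dx) := (ny :* dx :+ nx :* dy) :* (dx :* dy)) ℤ[q].refl (n x) (d x) (n y) (d y))

  +ᶠ-identityˡ : LeftIdentity 0ᶠ _+ᶠ_
  +ᶠ-identityˡ x@(frac _ _) = by-cross (solve 2 (λ nx dx →
    (con (+ 0) :* dx :+ nx :* con (+ 1)) :* dx := nx :* (con (+ 1) :* dx)) ℤ[q].refl (n x) (d x))

  -ᶠ-inverseˡ : LeftInverse 0ᶠ -ᶠ_ _+ᶠ_
  -ᶠ-inverseˡ x@(frac _ _) = by-cross (solve 2 (λ nx dx →
    (:- nx :* dx :+ nx :* dx) :* con (+ 1) := con (+ 0) :* (dx :* dx)) ℤ[q].refl (n x) (d x))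

  *ᶠ-assoc : Associative _*ᶠ_
  *ᶠ-assoc x@(frac _ _) y@(frac _ _) z@(frac _ _) = by-cross (solve 6 (λ nx dx ny dy nz dz →
    nx :* ny :* nz :* (dx :* (dy :* dz)) := nx :* (ny :* nz) :* (dx :* dy :* dz)) ℤ[q].refl (n x) (d x) (n y) (d y) (n z) (d z))

  *ᶠ-comm : Commutative _*ᶠ_
  *ᶠ-comm x@(frac _ _) y@(frac _ _) = by-cross (solve 4 (λ nx dx ny dy →
    nx :* ny :* (dy :* dx) := ny :* nx :* (dx :* dy)) ℤ[q].refl (n x) (d x) (n y) (d y))

  *ᶠ-identityˡ : LeftIdentity 1ᶠ _*ᶠ_
  *ᶠ-identityˡ x@(frac _ _) = by-cross (solve 2 (λ nx dx →
    con (+ 1) :* nx :* dx := nx :* (con (+ 1) :* dx)) ℤ[q].refl (n x) (d x))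

  *ᶠ-distribʳ : _*ᶠ_ DistributesOverʳ _+ᶠ_
  *ᶠ-distribʳ x@(frac _ _) y@(frac _ _) z@(frac _ _) = by-cross (solve 6 (λ nx dx ny dy nz dz →
    (ny :* dz :+ nz :* dy) :* nx :* (dy :* dx :* (dz :* dx))
    := (ny :* nx :* (dz :* dx) :+ nz :* nx :* (dy :* dx)) :* (dy :* dz :* dx)) ℤ[q].refl (n x) (d x) (n y) (d y) (n z) (d z))

  frac-isCommutativeRing : IsCommutativeRing _≈ᶠ_ _+ᶠ_ _*ᶠ_ -ᶠ_ 0ᶠ 1ᶠ
  frac-isCommutativeRing = record
    { isRing = record
      { +-isAbelianGroup = record
        { isGroup = record
          { isMonoid = record
            { isSemigroup = record { isMagma = record { isEquivalence = ≈ᶠ-isEquivalence ; ∙-cong = +ᶠ-cong } ; assoc = +ᶠ-assoc }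
            ; identity = comm∧idˡ⇒id +ᶠ-comm +ᶠ-identityˡ
            }
          ; inverse = comm∧invˡ⇒inv +ᶠ-comm -ᶠ-inverseˡ
          ; ⁻¹-cong = -ᶠ-cong
          }
        ; comm = +ᶠ-comm
        }
      ; *-cong = *ᶠ-cong
      ; *-assoc = *ᶠ-assoc
      ; *-identity = comm∧idˡ⇒id *ᶠ-comm *ᶠ-identityˡ
      ; distrib = comm∧distrʳ⇒distr +ᶠ-cong *ᶠ-comm *ᶠ-distribʳ
      }
    ; *-comm = *ᶠ-comm
    }
    where open import Algebra.Consequences.Setoid ≈ᶠ-setoid using (comm∧idˡ⇒id; comm∧invˡ⇒inv; comm∧distrʳ⇒distr)

fracRing : CommutativeRing _ _
fracRing = record { isCommutativeRing = frac-isCommutativeRing }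

private
  module F where
    open CommutativeRing fracRing public
    open import Algebra.Properties.Semiring.Exp semiring public using (_^_)
    open ListSums fracRing public
    open SetoidReasoning setoid public

-- Power series in x₁, …, xₙ over ℚ(q)

-- FPS n is Defs.PS n with coefficients in Frac; _+ˢ_, _*ˢ_, constˢ, varˢ, _·ˢ_, sumInfˢ mirror _+S_, _*S_,
-- constS, varS, _·S_, sumInf clause by clause, so each raw series of the statement is, coefficientwise,
-- the value of its ˢ-counterpart.
FPS : ℕ → Set
FPS n = MIdx n → Frac

infix 4 _≈ˢ_
record _≈ˢ_ {n} (f g : FPS n) : Set where
  constructor coeffwise
  field coeff : ∀ α → f α ≈ᶠ g α
open _≈ˢ_ public

infixl 6 _+ˢ_
infixl 7 _*ˢ_
infix  8 -ˢ_

_+ˢ_ : ∀ {n} → FPS n → FPS n → FPS n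
(f +ˢ g) α = f α +ᶠ g α

-ˢ_ : ∀ {n} → FPS n → FPS n
(-ˢ f) α = -ᶠ f α

_*ˢ_ : ∀ {n} → FPS n → FPS n → FPS n
(f *ˢ g) α = F.Σ (map (λ β → f β *ᶠ g (α -ᵢ β)) (below α))

constˢ : ∀ {n} → Frac → FPS n
constˢ {n} c α = if does (Vec.≡-dec ℕ._≟_ α (Vec.replicate n 0)) then c else 0ᶠ

0ˢ 1ˢ : ∀ {n} → FPS n
0ˢ _ = 0ᶠ
1ˢ = constˢ 1ᶠ

slice : ∀ {n} → FPS (suc n) → ℕ → FPS n
slice f a β = f (a ∷ β)

sumˢ-apply : ∀ {n} (fs : List (FPS n)) β → foldr _+ˢ_ 0ˢ fs β ≡ F.Σ (map (λ f → f β) fs)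
sumˢ-apply []       β = ≡.refl
sumˢ-apply (f ∷ fs) β = ≡.cong (f β +ᶠ_) (sumˢ-apply fs β)

FPS-isCommutativeRing : ∀ n → IsCommutativeRing (_≈ˢ_ {n}) _+ˢ_ _*ˢ_ -ˢ_ 0ˢ 1ˢ

FPS-ring : ℕ → CommutativeRing _ _
FPS-ring n = record { isCommutativeRing = FPS-isCommutativeRing n }

slice-⊛ : ∀ {n} (f g : FPS (suc n)) a → slice (f *ˢ g) a ≈ˢ PowerSeries._⊛_ (FPS-ring n) (slice f) (slice g) a
slice-⊛ {n} f g a = coeffwise λ β → F.begin
  F.Σ (map (term β) (concatMap (λ b → map (b ∷_) (below β)) (upTo (suc a))))
    F.≡⟨ ≡.cong F.Σ (List.map-concatMap (term β) (λ b → map (b ∷_) (below β)) (upTo (suc a))) ⟩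
  F.Σ (concatMap (λ b → map (term β) (map (b ∷_) (below β))) (upTo (suc a)))
    F.≈⟨ F.Σ-concatMap (λ b → map (term β) (map (b ∷_) (below β))) (upTo (suc a)) ⟩
  F.Σ (map (λ b → F.Σ (map (term β) (map (b ∷_) (below β)))) (upTo (suc a)))
    F.≡⟨ ≡.cong F.Σ (List.map-cong (λ b → ≡.cong F.Σ (≡.sym (List.map-∘ (below β)))) (upTo (suc a))) ⟩
  F.Σ (map (λ b → (slice f b *ˢ slice g (a ∸ b)) β) (upTo (suc a)))
    F.≡⟨ ≡.trans (≡.cong F.Σ (List.map-∘ (upTo (suc a))))
                 (≡.sym (sumˢ-apply (map (λ b → slice f b *ˢ slice g (a ∸ b)) (upTo (suc a))) β)) ⟩
  PowerSeries._⊛_ (FPS-ring n) (slice f) (slice g) a β F.∎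
  where
  term : MIdx n → MIdx (suc n) → Frac
  term β γ = f γ *ᶠ g ((a ∷ β) -ᵢ γ)

FPS-isCommutativeRing zero = isCommutativeRing-viaEmbedding _≈ˢ_ _+ˢ_ _*ˢ_ -ˢ_ 0ˢ 1ˢ fracRing (λ f → f [])
  (λ f≈g → coeff f≈g []) (λ f≈g → coeffwise λ { [] → f≈g })
  (λ f g → F.refl) (λ f g → F.+-identityʳ _) (λ f → F.refl) F.refl F.refl
FPS-isCommutativeRing (suc n) = isCommutativeRing-viaEmbedding _≈ˢ_ _+ˢ_ _*ˢ_ -ˢ_ 0ˢ 1ˢ S.seriesRing slice
  (λ f≈g → S.coeffwise (λ a → coeffwise (λ β → coeff f≈g (a ∷ β))))
  (λ f≈g → coeffwise λ { (a ∷ β) → coeff (S.coeff f≈g a) β })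
  (λ f g → S.coeffwise (λ a → coeffwise (λ β → F.refl)))
  (λ f g → S.coeffwise (slice-⊛ f g))
  (λ f → S.coeffwise (λ a → coeffwise (λ β → F.refl)))
  (S.coeffwise (λ a → coeffwise (λ β → F.refl)))
  (S.coeffwise λ { zero → coeffwise (λ β → F.refl) ; (suc a) → coeffwise (λ β → F.refl) })
  where module S = PowerSeries (FPS-ring n)

varˢ : ∀ {n} → Fin n → FPS n
varˢ i α = if does (Vec.≡-dec ℕ._≟_ α (unitIdx i)) then 1ᶠ else 0ᶠ

infixr 7 _·ˢ_
_·ˢ_ : ∀ {n} → Frac → FPS n → FPS n
(c ·ˢ f) α = c *ᶠ f α

_^ˢ_ : ∀ {n} → FPS n → ℕ → FPS n
_^ˢ_ {n} = _^_
  where open import Algebra.Properties.Semiring.Exp (CommutativeRing.semiring (FPS-ring n)) using (_^_)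

constˢ-*ˢ : ∀ {n} c (f : FPS n) → constˢ c *ˢ f ≈ˢ c ·ˢ f
constˢ-*ˢ {zero}  c f = coeffwise λ { [] → F.+-identityʳ _ }
constˢ-*ˢ {suc n} c f = coeffwise λ { (a ∷ α) → F.begin
  (constˢ c *ˢ f) (a ∷ α)
    F.≈⟨ coeff (slice-⊛ (constˢ c) f a) α ⟩
  (slice (constˢ c) S.⊛ slice f) a α
    F.≈⟨ coeff (S.⊛-cong {g = slice f} {g′ = slice f} slice-const (λ _ → coeffwise λ _ → F.refl) a) α ⟩
  (S.const (constˢ c) S.⊛ slice f) a α
    F.≈⟨ coeff (S.const-⊛ (constˢ c) (slice f) a) α ⟩
  (constˢ c *ˢ slice f a) α
    F.≈⟨ coeff (constˢ-*ˢ c (slice f a)) α ⟩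
  c *ᶠ f (a ∷ α) F.∎ }
  where
  module S = PowerSeries (FPS-ring n)
  slice-const : ∀ k → slice (constˢ c) k ≈ˢ S.const (constˢ c) k
  slice-const zero    = coeffwise λ β → F.refl
  slice-const (suc k) = coeffwise λ β → F.refl

module _ {n : ℕ} where
  private
    module PS = CommutativeRing (FPS-ring n)
    isZero? : MIdx n → Bool
    isZero? α = does (Vec.≡-dec ℕ._≟_ α (Vec.replicate n 0))

  constˢ-+ : ∀ a b → constˢ {n} (a +ᶠ b) ≈ˢ constˢ a +ˢ constˢ b
  constˢ-+ a b = coeffwise λ α → lemma (isZero? α)
    where
    lemma : ∀ t → (if t then a +ᶠ b else 0ᶠ) ≈ᶠ (if t then a else 0ᶠ) +ᶠ (if t then b else 0ᶠ)
    lemma true  = F.refl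
    lemma false = F.sym (F.+-identityʳ 0ᶠ)

  constˢ-neg : ∀ a → constˢ {n} (-ᶠ a) ≈ˢ -ˢ constˢ a
  constˢ-neg a = coeffwise λ α → lemma (isZero? α)
    where
    open import Algebra.Properties.Ring F.ring using (-0#≈0#)
    lemma : ∀ t → (if t then -ᶠ a else 0ᶠ) ≈ᶠ -ᶠ (if t then a else 0ᶠ)
    lemma true  = F.refl
    lemma false = F.sym -0#≈0#

  constˢ-* : ∀ a b → constˢ {n} (a *ᶠ b) ≈ˢ constˢ a *ˢ constˢ b
  constˢ-* a b = coeffwise λ α → F.trans (lemma (isZero? α)) (F.sym (coeff (constˢ-*ˢ a (constˢ b)) α))
    where
    lemma : ∀ t → (if t then a *ᶠ b else 0ᶠ) ≈ᶠ a *ᶠ (if t then b else 0ᶠ)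
    lemma true  = F.refl
    lemma false = F.sym (F.zeroʳ a)

  constˢ-^ : ∀ a m → constˢ {n} (a F.^ m) ≈ˢ constˢ a ^ˢ m
  constˢ-^ a zero    = PS.refl
  constˢ-^ a (suc m) = PS.trans (constˢ-* a (a F.^ m)) (PS.*-congˡ (constˢ-^ a m))

below-∣∣ : ∀ {n} (α : MIdx n) → All (λ β → ∣ β ∣ ℕ.+ ∣ α -ᵢ β ∣ ≡ ∣ α ∣) (below α)
below-∣∣ []      = ≡.refl ∷ []
below-∣∣ (a ∷ α) = All.concat⁺ (All.map⁺ (All.applyUpTo⁺₁ id (suc a) (λ {b} b<1+a →
  All.map⁺ (All.map (λ {β} ∣β∣+∣α-β∣≡∣α∣ → ≡.trans (interchange b _ (a ∸ b) _)
    (≡.cong₂ ℕ._+_ (ℕ.m+[n∸m]≡n (ℕ.≤-pred b<1+a)) ∣β∣+∣α-β∣≡∣α∣)) (below-∣∣ α)))))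
  where open import Algebra.Properties.CommutativeSemigroup ℕ.+-commutativeSemigroup using (interchange)

Order≥ : ∀ {n} → ℕ → FPS n → Set
Order≥ m f = ∀ γ → ∣ γ ∣ < m → f γ ≈ᶠ 0ᶠ

module _ {n : ℕ} where

  Order≥-zero : (f : FPS n) → Order≥ 0 f
  Order≥-zero f γ ()

  0ˢ-Order≥ : ∀ m → Order≥ m (0ˢ {n})
  0ˢ-Order≥ m γ _ = F.refl

  Order≥-mono : ∀ {m m′} {f : FPS n} → m′ ≤ m → Order≥ m f → Order≥ m′ f
  Order≥-mono m′≤m f≥m γ ∣γ∣<m′ = f≥m γ (ℕ.<-≤-trans ∣γ∣<m′ m′≤m)

  Order≥-+ : ∀ {m} {f g : FPS n} → Order≥ m f → Order≥ m g → Order≥ m (f +ˢ g)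
  Order≥-+ f≥m g≥m γ ∣γ∣<m = F.trans (F.+-cong (f≥m γ ∣γ∣<m) (g≥m γ ∣γ∣<m)) (F.+-identityˡ 0ᶠ)

  Order≥-neg : ∀ {m} {f : FPS n} → Order≥ m f → Order≥ m (-ˢ f)
  Order≥-neg f≥m γ ∣γ∣<m = F.trans (F.-‿cong (f≥m γ ∣γ∣<m)) -0#≈0#
    where open import Algebra.Properties.Ring F.ring using (-0#≈0#)

  Order≥-· : ∀ {m} c {f : FPS n} → Order≥ m f → Order≥ m (c ·ˢ f)
  Order≥-· c f≥m γ ∣γ∣<m = F.trans (F.*-congˡ (f≥m γ ∣γ∣<m)) (F.zeroʳ c)

  Order≥-* : ∀ {m₁ m₂} {f g : FPS n} → Order≥ m₁ f → Order≥ m₂ g → Order≥ (m₁ ℕ.+ m₂) (f *ˢ g)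
  Order≥-* {m₁} {m₂} {f} {g} f≥m₁ g≥m₂ γ ∣γ∣<m₁+m₂ = F.Σ-zero-All (All.map term≈0 (below-∣∣ γ))
    where
    term≈0 : ∀ {β} → ∣ β ∣ ℕ.+ ∣ γ -ᵢ β ∣ ≡ ∣ γ ∣ → f β *ᶠ g (γ -ᵢ β) ≈ᶠ 0ᶠ
    term≈0 {β} split with ∣ β ∣ ℕ.<? m₁
    ... | yes ∣β∣<m₁ = F.trans (F.*-congʳ (f≥m₁ β ∣β∣<m₁)) (F.zeroˡ _)
    ... | no  ∣β∣≮m₁ = F.trans (F.*-congˡ (g≥m₂ (γ -ᵢ β) (ℕ.+-cancelˡ-< m₁ _ _ (ℕ.≤-<-trans
          (ℕ.+-monoˡ-≤ ∣ γ -ᵢ β ∣ (ℕ.≮⇒≥ ∣β∣≮m₁)) (≡.subst (_< m₁ ℕ.+ m₂) (≡.sym split) ∣γ∣<m₁+m₂))))) (F.zeroʳ _)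

  Order≥-^ : ∀ {r : FPS n} → Order≥ 1 r → ∀ m → Order≥ m (r ^ˢ m)
  Order≥-^ r≥1 zero    = Order≥-zero _
  Order≥-^ r≥1 (suc m) = Order≥-* r≥1 (Order≥-^ r≥1 m)

  Order≥-Σ : ∀ {m} {fs : List (FPS n)} → All (Order≥ m) fs → Order≥ m (foldr _+ˢ_ 0ˢ fs)
  Order≥-Σ {m} []           = 0ˢ-Order≥ m
  Order≥-Σ     (f≥m ∷ fs≥m) = Order≥-+ f≥m (Order≥-Σ fs≥m)

∣unitIdx∣ : ∀ {n} (i : Fin n) → ∣ unitIdx i ∣ ≡ 1
∣unitIdx∣ {suc n} Fin.zero    = ≡.cong suc (∣zeros∣ n)
  where
  ∣zeros∣ : ∀ n → ∣ Vec.tabulate {n = n} (λ _ → 0) ∣ ≡ 0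
  ∣zeros∣ zero    = ≡.refl
  ∣zeros∣ (suc n) = ∣zeros∣ n
∣unitIdx∣ {suc n} (Fin.suc i) = ∣unitIdx∣ i

varˢ-Order≥ : ∀ {n} (i : Fin n) → Order≥ 1 (varˢ i)
varˢ-Order≥ i γ ∣γ∣<1 with Vec.≡-dec ℕ._≟_ γ (unitIdx i)
... | yes ≡.refl = ⊥-elim (ℕ.<-irrefl (∣unitIdx∣ i) ∣γ∣<1)
... | no  _    = F.refl

sumInfˢ : ∀ {n} → (ℕ → FPS n) → FPS n
sumInfˢ s α = F.Σ (map (λ k → s k α) (upTo (suc ∣ α ∣)))

Summable : ∀ {n} → (ℕ → FPS n) → Set
Summable s = ∀ k → Order≥ k (s k)

module _ {n : ℕ} where

  sumInfˢ-cong : ∀ {s t : ℕ → FPS n} → (∀ k → s k ≈ˢ t k) → sumInfˢ s ≈ˢ sumInfˢ t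
  sumInfˢ-cong s≈t = coeffwise λ α → F.Σ-cong (λ k → coeff (s≈t k) α) (upTo (suc ∣ α ∣))

  sumInfˢ-+ : ∀ (s t : ℕ → FPS n) → sumInfˢ (λ k → s k +ˢ t k) ≈ˢ sumInfˢ s +ˢ sumInfˢ t
  sumInfˢ-+ s t = coeffwise λ α → F.Σ-distrib-+ (λ k → s k α) (λ k → t k α) (upTo (suc ∣ α ∣))

  sumˢ-sumInfˢ : ∀ {A : Set} (s : A → ℕ → FPS n) xs →
                 foldr _+ˢ_ 0ˢ (map (λ i → sumInfˢ (s i)) xs) ≈ˢ sumInfˢ (λ k → foldr _+ˢ_ 0ˢ (map (λ i → s i k) xs))
  sumˢ-sumInfˢ s xs = coeffwise λ α → F.begin
    foldr _+ˢ_ 0ˢ (map (λ i → sumInfˢ (s i)) xs) α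
      F.≡⟨ ≡.trans (sumˢ-apply (map (λ i → sumInfˢ (s i)) xs) α) (≡.cong F.Σ (≡.sym (List.map-∘ xs))) ⟩
    F.Σ (map (λ i → sumInfˢ (s i) α) xs)
      F.≈⟨ F.Σ-comm (λ i k → s i k α) xs (upTo (suc ∣ α ∣)) ⟩
    F.Σ (map (λ k → F.Σ (map (λ i → s i k α) xs)) (upTo (suc ∣ α ∣)))
      F.≡⟨ ≡.cong F.Σ (List.map-cong (λ k → ≡.trans (≡.cong F.Σ (List.map-∘ xs)) (≡.sym (sumˢ-apply (map (λ i → s i k) xs) α)))
                                     (upTo (suc ∣ α ∣))) ⟩
    sumInfˢ (λ k → foldr _+ˢ_ 0ˢ (map (λ i → s i k) xs)) α F.∎

  *ˢ-sumInfˢ : ∀ (f : FPS n) {s} → Summable s → f *ˢ sumInfˢ s ≈ˢ sumInfˢ (λ k → f *ˢ s k)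
  *ˢ-sumInfˢ f {s} s-summable = coeffwise λ α → F.begin
    F.Σ (map (λ β → f β *ᶠ sumInfˢ s (α -ᵢ β)) (below α))
      F.≈⟨ F.Σ-cong-All (All.map (λ {β} split → F.*-congˡ (F.Σ-upTo-extend (λ k → s k (α -ᵢ β))
             (≡.subst (∣ α -ᵢ β ∣ ≤_) split (ℕ.m≤n+m _ ∣ β ∣)) (λ k → s-summable k (α -ᵢ β)))) (below-∣∣ α)) ⟩
    F.Σ (map (λ β → f β *ᶠ F.Σ (map (λ k → s k (α -ᵢ β)) (upTo (suc ∣ α ∣)))) (below α))
      F.≈⟨ F.Σ-cong (λ β → F.*-distribˡ-Σ (f β) (λ k → s k (α -ᵢ β)) (upTo (suc ∣ α ∣))) (below α) ⟨
    F.Σ (map (λ β → F.Σ (map (λ k → f β *ᶠ s k (α -ᵢ β)) (upTo (suc ∣ α ∣)))) (below α))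
      F.≈⟨ F.Σ-comm (λ β k → f β *ᶠ s k (α -ᵢ β)) (below α) (upTo (suc ∣ α ∣)) ⟩
    sumInfˢ (λ k → f *ˢ s k) α F.∎

  sumInfˢ-head : ∀ (s : ℕ → FPS n) → (∀ k → s (suc k) ≈ˢ 0ˢ) → sumInfˢ s ≈ˢ s 0
  sumInfˢ-head s tail≈0 = coeffwise λ α →
    F.trans (F.+-congˡ (F.Σ-zero-All (All.applyUpTo⁺₂ _ ∣ α ∣ (λ k → coeff (tail≈0 k) α)))) (F.+-identityʳ _)

  Summable-⊛ : ∀ {s t} → Summable s → Summable t → Summable (PowerSeries._⊛_ (FPS-ring n) s t)
  Summable-⊛ {s} {t} s-summable t-summable m = Order≥-Σ (All.map⁺ (All.applyUpTo⁺₁ id (suc m) λ {k} k<1+m →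
    ≡.subst (λ d → Order≥ d (s k *ˢ t (m ∸ k))) (ℕ.m+[n∸m]≡n (ℕ.≤-pred k<1+m)) (Order≥-* (s-summable k) (t-summable (m ∸ k)))))

does-≟-sym : ∀ {n} (i j : Fin n) → does (i Fin.≟ j) ≡ does (j Fin.≟ i)
does-≟-sym i j with i Fin.≟ j | j Fin.≟ i
... | yes _   | yes _   = ≡.refl
... | no  _   | no  _   = ≡.refl
... | yes i≡j | no  j≢i = contradiction (≡.sym i≡j) j≢i
... | no  i≢j | yes j≡i = contradiction (≡.sym j≡i) i≢j

module ListEncodings {c ℓ} (R : CommutativeRing c ℓ) where
  open CommutativeRing R hiding (zero)
  open ListSums R
  open FiniteProducts R
  open PartialFractions R using (Δ)
  open SetoidReasoning setoid

  Σ-tabulate : ∀ {n} (t : Vector Carrier n) → Σ (tabulate t) ≡ sum t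
  Σ-tabulate {zero}  t = ≡.refl
  Σ-tabulate {suc n} t = ≡.cong (_+_ (t zero)) (Σ-tabulate (t ∘ suc))

  Π-tabulate : ∀ {n} (t : Vector Carrier n) → Π (tabulate t) ≡ ∏ t
  Π-tabulate {zero}  t = ≡.refl
  Π-tabulate {suc n} t = ≡.cong (t zero *_) (Π-tabulate (t ∘ suc))

  Σ-allFin : ∀ {n} (t : Vector Carrier n) → Σ (map t (allFin n)) ≈ sum t
  Σ-allFin t = reflexive (≡.trans (≡.cong Σ (List.map-tabulate id t)) (Σ-tabulate t))

  Π-allFin : ∀ {n} (t : Vector Carrier n) → Π (map t (allFin n)) ≈ ∏ t
  Π-allFin t = reflexive (≡.trans (≡.cong Π (List.map-tabulate id t)) (Π-tabulate t))

  Π-concatMap-if : ∀ {a} {A : Set a} (skip : A → Bool) (t : A → Carrier) xs →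
                   Π (concatMap (λ j → if skip j then [] else t j ∷ []) xs) ≈ Π (map (λ j → if skip j then 1# else t j) xs)
  Π-concatMap-if skip t []       = refl
  Π-concatMap-if skip t (x ∷ xs) with skip x
  ... | true  = trans (Π-concatMap-if skip t xs) (sym (*-identityˡ _))
  ... | false = *-congˡ (Π-concatMap-if skip t xs)

  ∏-if-≟ : ∀ {n} (i : Fin n) (t : Vector Carrier n) → ∏ (λ j → if does (j Fin.≟ i) then 1# else t j) ≈ ∏≠ i t
  ∏-if-≟ zero    t = *-identityˡ _
  ∏-if-≟ (suc i) t = *-congˡ (∏-if-≟ i (t ∘ suc))

  Π-filter-≟ : ∀ {n} (i : Fin n) (t : Vector Carrier n) →
               Π (concatMap (λ j → if does (j Fin.≟ i) then [] else t j ∷ []) (allFin n)) ≈ ∏≠ i t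
  Π-filter-≟ i t = trans (Π-concatMap-if (λ j → does (j Fin.≟ i)) t (allFin _))
                         (trans (Π-allFin (λ j → if does (j Fin.≟ i) then 1# else t j)) (∏-if-≟ i t))

  module _ {n} (x : Vector Carrier n) where

    difference : Fin n × Fin n → Carrier
    difference (a , b) = x a - x b

    Π-pairsExcept : ∀ (skip : Fin n → Bool) →
                    Π (map difference (pairsExcept skip)) ≈ ∏ (λ a → if skip a then 1# else Δ x a)
    Π-pairsExcept skip = begin
      Π (map difference (pairsExcept skip))
        ≡⟨ ≡.cong Π (≡.trans (List.map-concatMap difference pairsFrom (allFin n))
                             (List.concatMap-cong (λ a → ≡.trans (List.map-concatMap difference _ (allFin n))
                               (List.concatMap-cong (λ b → Bool.if-float (map difference) (does (a Fin.≟ b) ∨ skip a)) (allFin n))) (allFin n))) ⟩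
      Π (concatMap differencesFrom (allFin n))
        ≈⟨ trans (Π-concatMap differencesFrom (allFin n)) (Π-allFin (Π ∘ differencesFrom)) ⟩
      ∏ (λ a → Π (differencesFrom a))
        ≈⟨ ∏-cong (λ a → trans (Π-concatMap-if (λ b → does (a Fin.≟ b) ∨ skip a) (λ b → x a - x b) (allFin n))
                         (trans (Π-allFin (λ b → if does (a Fin.≟ b) ∨ skip a then 1# else x a - x b)) (row a (skip a)))) ⟩
      ∏ (λ a → if skip a then 1# else Δ x a) ∎
      where
      differencesFrom : Fin n → List Carrier
      differencesFrom a = concatMap (λ b → if does (a Fin.≟ b) ∨ skip a then [] else difference (a , b) ∷ []) (allFin n)
      pairsFrom : Fin n → List (Fin n × Fin n)
      pairsFrom a = concatMap (λ b → if does (a Fin.≟ b) ∨ skip a then [] else (a , b) ∷ []) (allFin n)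
      row : ∀ a σ → ∏ (λ b → if does (a Fin.≟ b) ∨ σ then 1# else x a - x b) ≈ (if σ then 1# else Δ x a)
      row a true  = trans (∏-cong (λ b → reflexive (≡.cong (if_then 1# else x a - x b) (Bool.∨-zeroʳ _)))) (∏-replicate-1# n)
      row a false = trans (∏-cong (λ b → reflexive (≡.cong (if_then 1# else x a - x b)
                      (≡.trans (Bool.∨-identityʳ _) (does-≟-sym a b))))) (∏-if-≟ a (λ b → x a - x b))

-- The generating function Ω[(q - 1) z Xₙ]

module OmegaExpansion (n : ℕ) where
  private
    module Z where
      open PowerSeries (FPS-ring n) public
      open CommutativeRing seriesRing public
      open import Algebra.Properties.Semiring.Exp semiring public using (_^_)
      open import Algebra.Properties.CommutativeSemigroup *-commutativeSemigroup public using (xy∙z≈xz∙y)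
      open ListSums seriesRing public
      open FiniteProducts seriesRing public
      open PartialFractions seriesRing public
      open ListEncodings seriesRing public
      open SetoidReasoning setoid public
    module H = HomomorphicImages (FPS-ring n) Z.seriesRing Z.const-isRingHomomorphism

  open CommutativeRing (FPS-ring n) hiding (zero)
  open SetoidReasoning setoid
  open import Algebra.Properties.Semiring.Exp semiring using (_^_)
  open import Algebra.Properties.Ring ring using (-0#≈0#)
  open FiniteProducts (FPS-ring n)
  open PartialFractions (FPS-ring n)

  qˢ : FPS n
  qˢ = constˢ qᶠ

  geomˢ : Fin n → ℕ → FPS n
  geomˢ i m = (qᶠ ·ˢ varˢ i) ^ˢ m

  oneMinusZxˢ : Fin n → ℕ → FPS n
  oneMinusZxˢ i zero          = 1ˢ
  oneMinusZxˢ i (suc zero)    = -ˢ varˢ i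
  oneMinusZxˢ i (suc (suc _)) = 0ˢ

  Ωˢ : ℕ → FPS n
  Ωˢ = foldr (λ i acc → (oneMinusZxˢ i Z.⊛ geomˢ i) Z.⊛ acc) Z.𝟙 (allFin n)

  X : Vector Z.Series n
  X i = Z.const (varˢ i)

  oneMinusZxˢ-asSeries : ∀ i → Z.𝟙 Z.- Z.z Z.⊛ X i Z.≋ oneMinusZxˢ i
  oneMinusZxˢ-asSeries i = Z.coeffwise λ
    { zero          → trans (+-congˡ (trans (-‿cong (Z.z-⊛-zero (X i))) -0#≈0#)) (+-identityʳ _)
    ; (suc zero)    → trans (+-congˡ (-‿cong (Z.z-⊛-suc (X i) 0))) (+-identityˡ _)
    ; (suc (suc m)) → trans (+-congˡ (trans (-‿cong (Z.z-⊛-suc (X i) (suc m))) -0#≈0#)) (+-identityˡ _)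
    }

  geomˢ-inverse : ∀ i → (Z.1# Z.- Z.const qˢ Z.* Z.z Z.* X i) Z.* geomˢ i Z.≈ Z.1#
  geomˢ-inverse i = Z.begin
    (Z.1# Z.- Z.const qˢ Z.* Z.z Z.* X i) Z.* geomˢ i
      Z.≈⟨ Z.*-congʳ {geomˢ i} (Z.+-congˡ (Z.-‿cong (Z.trans (Z.xy∙z≈xz∙y (Z.const qˢ) Z.z (X i))
           (Z.*-congʳ {Z.z} (Z.sym (IsRingHomomorphism.*-homo Z.const-isRingHomomorphism qˢ (varˢ i))))))) ⟩
    (Z.1# Z.- Z.const (qˢ * varˢ i) Z.* Z.z) Z.* geomˢ i
      Z.≈⟨ Z.geometric-inverse (qˢ * varˢ i) (geomˢ i) refl (λ m → *-congʳ {geomˢ i m} (sym (constˢ-*ˢ qᶠ (varˢ i)))) ⟩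
    Z.1# Z.∎

  Ωˢ-asProduct : Z.∏ (λ i → (Z.1# Z.- Z.z Z.* X i) Z.* geomˢ i) Z.≈ Ωˢ
  Ωˢ-asProduct = Z.begin
    Z.∏ (λ i → (Z.1# Z.- Z.z Z.* X i) Z.* geomˢ i)
      Z.≈⟨ Z.∏-cong (λ i → Z.*-congʳ {geomˢ i} (oneMinusZxˢ-asSeries i)) ⟩
    Z.∏ (λ i → oneMinusZxˢ i Z.⊛ geomˢ i)
      Z.≈⟨ Z.Π-allFin (λ i → oneMinusZxˢ i Z.⊛ geomˢ i) ⟨
    Z.Π (map (λ i → oneMinusZxˢ i Z.⊛ geomˢ i) (allFin n))
      Z.≡⟨ List.foldr-map Z._⊛_ (λ i → oneMinusZxˢ i Z.⊛ geomˢ i) Z.𝟙 (allFin n) ⟩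
    Ωˢ Z.∎

  geomˢ-summable : ∀ i → Summable (geomˢ i)
  geomˢ-summable i = Order≥-^ (Order≥-· qᶠ (varˢ-Order≥ i))

  Ωˢ-summable : Summable Ωˢ
  Ωˢ-summable = foldr-summable (allFin n)
    where
    oneMinusZxˢ-summable : ∀ i → Summable (oneMinusZxˢ i)
    oneMinusZxˢ-summable i zero          = Order≥-zero _
    oneMinusZxˢ-summable i (suc zero)    = Order≥-neg (varˢ-Order≥ i)
    oneMinusZxˢ-summable i (suc (suc m)) = 0ˢ-Order≥ _
    𝟙-summable : Summable Z.𝟙
    𝟙-summable zero    = Order≥-zero _
    𝟙-summable (suc m) = 0ˢ-Order≥ _
    foldr-summable : ∀ is → Summable (foldr (λ i acc → (oneMinusZxˢ i Z.⊛ geomˢ i) Z.⊛ acc) Z.𝟙 is)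
    foldr-summable []       = 𝟙-summable
    foldr-summable (i ∷ is) = Summable-⊛ (Summable-⊛ (oneMinusZxˢ-summable i) (geomˢ-summable i)) (foldr-summable is)

  D : FPS n
  D = disc varˢ

  Ω-generatingFunction : Z.const (qˢ ^ n * D) Z.* Ωˢ
                         Z.≈ Z.const D Z.+ Z.const (qˢ - 1ˢ) Z.* Z.sum (λ i → Z.const (numer varˢ qˢ i * discExcept varˢ i) Z.* geomˢ i)
  Ω-generatingFunction = Z.begin
    Z.const (qˢ ^ n * D) Z.* Ωˢ
      Z.≈⟨ Z.*-cong (Z.trans (H.*-homo (qˢ ^ n) D) (Z.*-cong (H.h-^ qˢ n) (H.h-disc varˢ))) (Z.sym Ωˢ-asProduct) ⟩
    Z.const qˢ Z.^ n Z.* Z.disc X Z.* Z.∏ (λ i → (Z.1# Z.- Z.z Z.* X i) Z.* geomˢ i)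
      Z.≈⟨ InvertedPartialFractions.partialFractions-inverted Z.seriesRing X (Z.const qˢ) Z.z geomˢ geomˢ-inverse ⟩
    Z.disc X Z.+ (Z.const qˢ Z.- Z.1#) Z.* Z.sum (λ i → Z.numer X (Z.const qˢ) i Z.* Z.discExcept X i Z.* geomˢ i)
      Z.≈⟨ Z.+-cong (H.h-disc varˢ) (Z.*-cong (Z.trans (H.h-minus qˢ 1ˢ) (Z.+-congˡ (Z.-‿cong H.1#-homo)))
              (Z.sum-cong-≋ (λ i → Z.*-congʳ {geomˢ i} (Z.trans (H.*-homo _ _) (Z.*-cong (H.h-numer varˢ qˢ i) (H.h-discExcept varˢ i)))))) ⟨
    Z.const D Z.+ Z.const (qˢ - 1ˢ) Z.* Z.sum (λ i → Z.const (numer varˢ qˢ i * discExcept varˢ i) Z.* geomˢ i) Z.∎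

  Ω-coefficient : ∀ m → qˢ ^ n * D * Ωˢ m
                        ≈ Z.const D m + (qˢ - 1ˢ) * sum (λ i → numer varˢ qˢ i * discExcept varˢ i * geomˢ i m)
  Ω-coefficient m = begin
    qˢ ^ n * D * Ωˢ m
      ≈⟨ Z.const-⊛ (qˢ ^ n * D) Ωˢ m ⟨
    (Z.const (qˢ ^ n * D) Z.* Ωˢ) m
      ≈⟨ Z.coeff Ω-generatingFunction m ⟩
    Z.const D m + (Z.const (qˢ - 1ˢ) Z.* Z.sum F) m
      ≈⟨ +-congˡ (trans (Z.const-⊛ (qˢ - 1ˢ) (Z.sum F) m)
              (*-congˡ (trans (sum-coefficient F) (sum-cong-≋ (λ i → Z.const-⊛ _ (geomˢ i) m))))) ⟩
    Z.const D m + (qˢ - 1ˢ) * sum (λ i → numer varˢ qˢ i * discExcept varˢ i * geomˢ i m) ∎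
    where
    F : Vector Z.Series n
    F i = Z.const (numer varˢ qˢ i * discExcept varˢ i) Z.* geomˢ i
    sum-coefficient : ∀ {k} (G : Vector Z.Series k) → Z.sum G m ≈ sum (λ i → G i m)
    sum-coefficient {zero}  G = refl
    sum-coefficient {suc k} G = +-congˡ (sum-coefficient (G ∘ suc))

module Expansion (n : ℕ) (c : ℕ → Frac) (v : ℕ) where
  open OmegaExpansion n
  open CommutativeRing (FPS-ring n) hiding (zero)
  open SetoidReasoning setoid
  open ListSums (FPS-ring n)
  open FiniteProducts (FPS-ring n)
  open PartialFractions (FPS-ring n)
  open ListEncodings (FPS-ring n)
  open import Algebra.Properties.Semiring.Exp semiring using (_^_; ^-homo-*)
  open import Algebra.Properties.CommutativeSemigroup *-commutativeSemigroup using (x∙yz≈y∙xz)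
  open RingSolver (FPS-ring n)
  private
    module Z = PowerSeries (FPS-ring n)

  χᶠ : ℕ → Frac
  χᶠ zero    = 1ᶠ
  χᶠ (suc _) = 0ᶠ

  Dallˢ : FPS n
  Dallˢ = Π (map (difference varˢ) (pairsExcept (λ _ → false)))

  Dexceptˢ : Fin n → FPS n
  Dexceptˢ i = Π (map (difference varˢ) (pairsExcept (λ a → does (a Fin.≟ i))))

  numProdˢ : Fin n → FPS n
  numProdˢ i = Π (concatMap (λ j → if does (j Fin.≟ i) then [] else ((qᶠ ·ˢ varˢ i) - varˢ j) ∷ []) (allFin n))

  evalQxˢ : Fin n → FPS n
  evalQxˢ i = sumInfˢ (λ k → c k ·ˢ geomˢ i k)

  lhsCoeffˢ : FPS n
  lhsCoeffˢ = sumInfˢ (λ k → c k ·ˢ Ωˢ (v ℕ.+ k))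

  rhsSumˢ : FPS n
  rhsSumˢ = Σ (map (λ i → numProdˢ i *ˢ (Dexceptˢ i *ˢ (geomˢ i v *ˢ evalQxˢ i))) (allFin n))

  C : ℕ → FPS n
  C k = constˢ (c k)

  N E : Fin n → FPS n
  N i = numer varˢ qˢ i
  E i = discExcept varˢ i

  Dallˢ≈D : Dallˢ ≈ˢ D
  Dallˢ≈D = Π-pairsExcept varˢ (λ _ → false)

  Dexceptˢ≈E : ∀ i → Dexceptˢ i ≈ˢ E i
  Dexceptˢ≈E i = trans (Π-pairsExcept varˢ (λ a → does (a Fin.≟ i))) (∏-if-≟ i (Δ varˢ))

  numProdˢ≈N : ∀ i → numProdˢ i ≈ˢ N i
  numProdˢ≈N i = trans (Π-filter-≟ i (λ j → (qᶠ ·ˢ varˢ i) - varˢ j))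
                          (∏≠-cong i (λ j → +-congʳ (sym (constˢ-*ˢ qᶠ (varˢ i)))))

  S : ℕ → FPS n
  S m = sum (λ i → N i * E i * geomˢ i m)

  lhs-expansion : (qᶠ F.^ n) ·ˢ (Dallˢ *ˢ lhsCoeffˢ)
                  ≈ˢ sumInfˢ (λ k → C k * (Z.const D (v ℕ.+ k) + (qˢ - 1ˢ) * S (v ℕ.+ k)))
  lhs-expansion = begin
    (qᶠ F.^ n) ·ˢ (Dallˢ *ˢ lhsCoeffˢ)
      ≈⟨ constˢ-*ˢ (qᶠ F.^ n) (Dallˢ *ˢ lhsCoeffˢ) ⟨
    constˢ (qᶠ F.^ n) * (Dallˢ * lhsCoeffˢ)
      ≈⟨ *-cong (constˢ-^ qᶠ n) (*-cong Dallˢ≈D (sumInfˢ-cong (λ k → sym (constˢ-*ˢ (c k) (Ωˢ (v ℕ.+ k)))))) ⟩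
    qˢ ^ n * (D * sumInfˢ (λ k → C k * Ωˢ (v ℕ.+ k)))
      ≈⟨ *-assoc (qˢ ^ n) D (sumInfˢ (λ k → C k * Ωˢ (v ℕ.+ k))) ⟨
    qˢ ^ n * D * sumInfˢ (λ k → C k * Ωˢ (v ℕ.+ k))
      ≈⟨ *ˢ-sumInfˢ (qˢ ^ n * D) (λ k → Order≥-* (Order≥-zero (C k))
                                                   (Order≥-mono {f = Ωˢ (v ℕ.+ k)} (ℕ.m≤n+m k v) (Ωˢ-summable (v ℕ.+ k)))) ⟩
    sumInfˢ (λ k → qˢ ^ n * D * (C k * Ωˢ (v ℕ.+ k)))
      ≈⟨ sumInfˢ-cong (λ k → trans (x∙yz≈y∙xz (qˢ ^ n * D) (C k) (Ωˢ (v ℕ.+ k))) (*-congˡ (Ω-coefficient (v ℕ.+ k)))) ⟩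
    sumInfˢ (λ k → C k * (Z.const D (v ℕ.+ k) + (qˢ - 1ˢ) * S (v ℕ.+ k))) ∎

  constantTerm : sumInfˢ (λ k → C k * Z.const D (v ℕ.+ k)) ≈ˢ χᶠ v ·ˢ (Dallˢ *ˢ constˢ (c 0))
  constantTerm = trans (sumInfˢ-head _ tail≈0) (trans (reflexive (≡.cong (λ m → C 0 * Z.const D m) (ℕ.+-identityʳ v))) (firstTerm v))
    where
    tail≈0 : ∀ k → C (suc k) * Z.const D (v ℕ.+ suc k) ≈ˢ 0ˢ
    tail≈0 k = trans (reflexive (≡.cong (λ m → C (suc k) * Z.const D m) (ℕ.+-suc v k))) (zeroʳ _)
    firstTerm : ∀ v → C 0 * Z.const D v ≈ˢ χᶠ v ·ˢ (Dallˢ *ˢ constˢ (c 0))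
    firstTerm zero    = trans (*-comm (C 0) D) (trans (*-congʳ {C 0} (sym Dallˢ≈D)) (coeffwise λ α → F.sym (F.*-identityˡ ((Dallˢ *ˢ C 0) α))))
    firstTerm (suc v) = trans (zeroʳ _) (coeffwise λ α → F.sym (F.zeroˡ _))

  geometricTerm : sumInfˢ (λ k → C k * ((qˢ - 1ˢ) * S (v ℕ.+ k)))
                  ≈ˢ (qᶠ +ᶠ (-ᶠ 1ᶠ)) ·ˢ rhsSumˢ
  geometricTerm = sym (begin
    (qᶠ +ᶠ (-ᶠ 1ᶠ)) ·ˢ rhsSumˢ
      ≈⟨ trans (sym (constˢ-*ˢ (qᶠ +ᶠ (-ᶠ 1ᶠ)) (rhsSumˢ)))
             (*-cong (trans (constˢ-+ qᶠ (-ᶠ 1ᶠ)) (+-congˡ (constˢ-neg 1ᶠ))) (Σ-cong termᵢ (allFin n))) ⟩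
    (qˢ - 1ˢ) * Σ (map (λ i → sumInfˢ (t i)) (allFin n))
      ≈⟨ *-congˡ (sumˢ-sumInfˢ t (allFin n)) ⟩
    (qˢ - 1ˢ) * sumInfˢ (λ k → Σ (map (λ i → t i k) (allFin n)))
      ≈⟨ *ˢ-sumInfˢ (qˢ - 1ˢ) (λ k → Order≥-Σ (All.map⁺ (All.universal (λ i → t-summable i k) (allFin n)))) ⟩
    sumInfˢ (λ k → (qˢ - 1ˢ) * Σ (map (λ i → t i k) (allFin n)))
      ≈⟨ sumInfˢ-cong termₖ ⟩
    sumInfˢ (λ k → C k * ((qˢ - 1ˢ) * S (v ℕ.+ k))) ∎)
    where
    t : Fin n → ℕ → FPS n
    t i k = N i * E i * geomˢ i v * (C k * geomˢ i k)

    t-summable : ∀ i → Summable (t i)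
    t-summable i k = Order≥-* (Order≥-zero _) (Order≥-* (Order≥-zero (C k)) (geomˢ-summable i k))

    termᵢ : ∀ i → numProdˢ i *ˢ (Dexceptˢ i *ˢ (geomˢ i v *ˢ evalQxˢ i)) ≈ˢ sumInfˢ (t i)
    termᵢ i = begin
      numProdˢ i * (Dexceptˢ i * (geomˢ i v * evalQxˢ i))
        ≈⟨ *-cong (numProdˢ≈N i) (*-cong (Dexceptˢ≈E i) (*-congˡ (sumInfˢ-cong (λ k → sym (constˢ-*ˢ (c k) (geomˢ i k)))))) ⟩
      N i * (E i * (geomˢ i v * sumInfˢ (λ k → C k * geomˢ i k)))
        ≈⟨ solve 4 (λ a b d s → a :* (b :* (d :* s)) := a :* b :* d :* s) refl (N i) (E i) (geomˢ i v) (sumInfˢ (λ k → C k * geomˢ i k)) ⟩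
      N i * E i * geomˢ i v * sumInfˢ (λ k → C k * geomˢ i k)
        ≈⟨ *ˢ-sumInfˢ (N i * E i * geomˢ i v) (λ k → Order≥-* (Order≥-zero (C k)) (geomˢ-summable i k)) ⟩
      sumInfˢ (t i) ∎

    termₖ : ∀ k → (qˢ - 1ˢ) * Σ (map (λ i → t i k) (allFin n)) ≈ˢ C k * ((qˢ - 1ˢ) * S (v ℕ.+ k))
    termₖ k = begin
      (qˢ - 1ˢ) * Σ (map (λ i → t i k) (allFin n))
        ≈⟨ *-congˡ (Σ-allFin (λ i → t i k)) ⟩
      (qˢ - 1ˢ) * sum (λ i → t i k)
        ≈⟨ *-congˡ (sum-cong-≋ (λ i → trans
               (solve 5 (λ a b d c g → a :* b :* d :* (c :* g) := c :* (a :* b :* (d :* g))) refl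
                  (N i) (E i) (geomˢ i v) (C k) (geomˢ i k))
               (*-congˡ (*-congˡ (sym (^-homo-* (qᶠ ·ˢ varˢ i) v k)))))) ⟩
      (qˢ - 1ˢ) * sum (λ i → C k * (N i * E i * geomˢ i (v ℕ.+ k)))
        ≈⟨ *-congˡ (*-distribˡ-sum (C k) (λ i → N i * E i * geomˢ i (v ℕ.+ k))) ⟨
      (qˢ - 1ˢ) * (C k * S (v ℕ.+ k))
        ≈⟨ x∙yz≈y∙xz (qˢ - 1ˢ) (C k) (S (v ℕ.+ k)) ⟩
      C k * ((qˢ - 1ˢ) * S (v ℕ.+ k)) ∎

  proposition4p3ˢ : (qᶠ F.^ n) ·ˢ (Dallˢ *ˢ lhsCoeffˢ)
              ≈ˢ (χᶠ v ·ˢ (Dallˢ *ˢ constˢ (c 0)))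
                 +ˢ ((qᶠ +ᶠ (-ᶠ 1ᶠ)) ·ˢ rhsSumˢ)
  proposition4p3ˢ = begin
    (qᶠ F.^ n) ·ˢ (Dallˢ *ˢ lhsCoeffˢ)
      ≈⟨ lhs-expansion ⟩
    sumInfˢ (λ k → C k * (Z.const D (v ℕ.+ k) + (qˢ - 1ˢ) * S (v ℕ.+ k)))
      ≈⟨ trans (sumInfˢ-cong (λ k → distribˡ (C k) (Z.const D (v ℕ.+ k)) ((qˢ - 1ˢ) * S (v ℕ.+ k))))
             (sumInfˢ-+ (λ k → C k * Z.const D (v ℕ.+ k)) (λ k → C k * ((qˢ - 1ˢ) * S (v ℕ.+ k)))) ⟩
    sumInfˢ (λ k → C k * Z.const D (v ℕ.+ k)) + sumInfˢ (λ k → C k * ((qˢ - 1ˢ) * S (v ℕ.+ k)))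
      ≈⟨ +-cong constantTerm geometricTerm ⟩
    (χᶠ v ·ˢ (Dallˢ *ˢ constˢ (c 0)))
      +ˢ ((qᶠ +ᶠ (-ᶠ 1ᶠ)) ·ˢ rhsSumˢ) ∎

-- Back to raw fractions

val-+ : ∀ x y → val (x +ᶠ y) ≡ val x +K val y
val-+ (frac _ _) (frac _ _) = ≡.refl

val-* : ∀ x y → val (x *ᶠ y) ≡ val x *K val y
val-* (frac _ _) (frac _ _) = ≡.refl

val-neg : ∀ x → val (-ᶠ x) ≡ -K val x
val-neg (frac _ _) = ≡.refl

val-Σ : ∀ {A : Set} (h : A → Frac) xs → val (F.Σ (map h xs)) ≡ sumK (map (val ∘ h) xs)
val-Σ h []       = ≡.refl
val-Σ h (x ∷ xs) = ≡.trans (val-+ (h x) _) (≡.cong (val (h x) +K_) (val-Σ h xs))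

val-if : ∀ (b : Bool) x y → val (if b then x else y) ≡ (if b then val x else val y)
val-if true  x y = ≡.refl
val-if false x y = ≡.refl

val-^ : ∀ x m → val (x F.^ m) ≡ val x ^K m
val-^ x zero    = ≡.refl
val-^ x (suc m) = ≡.trans (val-* x (x F.^ m)) (≡.cong (val x *K_) (val-^ x m))

module _ {n : ℕ} where
  private
    module PS where
      open CommutativeRing (FPS-ring n) public
      open ListSums (FPS-ring n) public

  -- ≈S compares raw fractions by cross-multiplication, which is transitive only for nonzero
  -- denominators; so the identity is proved in FPS n and transported back along this relation.
  infix 4 _≡ᵛ_
  record _≡ᵛ_ (f : PS n) (F : FPS n) : Set where
    constructor valuewise
    field coeff-≡ : ∀ α → f α ≡ val (F α)
  open _≡ᵛ_ public

  ≡ᵛ-+ : ∀ {f g F G} → f ≡ᵛ F → g ≡ᵛ G → f +S g ≡ᵛ F +ˢ G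
  ≡ᵛ-+ {F = F} {G} f≡F g≡G = valuewise λ α → ≡.trans (≡.cong₂ _+K_ (coeff-≡ f≡F α) (coeff-≡ g≡G α)) (≡.sym (val-+ (F α) (G α)))

  ≡ᵛ-neg : ∀ {f F} → f ≡ᵛ F → -S f ≡ᵛ -ˢ F
  ≡ᵛ-neg {F = F} f≡F = valuewise λ α → ≡.trans (≡.cong -K_ (coeff-≡ f≡F α)) (≡.sym (val-neg (F α)))

  ≡ᵛ-- : ∀ {f g F G} → f ≡ᵛ F → g ≡ᵛ G → f -S g ≡ᵛ F PS.- G
  ≡ᵛ-- f≡F g≡G = ≡ᵛ-+ f≡F (≡ᵛ-neg g≡G)

  ≡ᵛ-· : ∀ {a f} x {F} → a ≡ val x → f ≡ᵛ F → a ·S f ≡ᵛ x ·ˢ F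
  ≡ᵛ-· x {F} a≡x f≡F = valuewise λ α → ≡.trans (≡.cong₂ _*K_ a≡x (coeff-≡ f≡F α)) (≡.sym (val-* x (F α)))

  ≡ᵛ-* : ∀ {f g F G} → f ≡ᵛ F → g ≡ᵛ G → f *S g ≡ᵛ F *ˢ G
  ≡ᵛ-* {F = F} {G} f≡F g≡G = valuewise λ α → ≡.trans
    (≡.cong sumK (List.map-cong (λ β → ≡.cong₂ _*K_ (coeff-≡ f≡F β) (coeff-≡ g≡G (α -ᵢ β))) (below α)))
    (≡.sym (≡.trans (val-Σ (λ β → F β *ᶠ G (α -ᵢ β)) (below α))
                    (≡.cong sumK (List.map-cong (λ β → val-* (F β) (G (α -ᵢ β))) (below α)))))

  ≡ᵛ-const : ∀ x → constS (val x) ≡ᵛ constˢ {n} x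
  ≡ᵛ-const x = valuewise λ α → ≡.sym (val-if _ x 0ᶠ)

  ≡ᵛ-var : ∀ i → varS i ≡ᵛ varˢ i
  ≡ᵛ-var i = valuewise λ α → ≡.sym (val-if _ 1ᶠ 0ᶠ)

  ≡ᵛ-^ : ∀ {f F} → f ≡ᵛ F → ∀ m → f ^S m ≡ᵛ F ^ˢ m
  ≡ᵛ-^ f≡F zero    = ≡ᵛ-const 1ᶠ
  ≡ᵛ-^ f≡F (suc m) = ≡ᵛ-* f≡F (≡ᵛ-^ f≡F m)

  ≡ᵛ-sumInf : ∀ {s S} → (∀ k → s k ≡ᵛ S k) → sumInf s ≡ᵛ sumInfˢ S
  ≡ᵛ-sumInf {S = S} s≡S = valuewise λ α → ≡.trans
    (≡.cong sumK (List.map-cong (λ k → coeff-≡ (s≡S k) α) (upTo (suc ∣ α ∣))))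
    (≡.sym (val-Σ (λ k → S k α) (upTo (suc ∣ α ∣))))

  ≡ᵛ-Σ : ∀ {fs Fs} → Pointwise _≡ᵛ_ fs Fs → sumS fs ≡ᵛ PS.Σ Fs
  ≡ᵛ-Σ = Pointwise.foldr⁺ ≡ᵛ-+ (valuewise λ _ → ≡.refl)

  ≡ᵛ-Π : ∀ {fs Fs} → Pointwise _≡ᵛ_ fs Fs → prodS fs ≡ᵛ PS.Π Fs
  ≡ᵛ-Π = Pointwise.foldr⁺ ≡ᵛ-* (≡ᵛ-const 1ᶠ)

  ≡ᵛ-map : ∀ {A : Set} {h : A → PS n} {H : A → FPS n} → (∀ x → h x ≡ᵛ H x) → ∀ xs → Pointwise _≡ᵛ_ (map h xs) (map H xs)
  ≡ᵛ-map h≡H xs = Pointwise.map⁺ _ _ (Pointwise.refl (λ {x} → h≡H x) {xs})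

  ≡ᵛ-concatMap : ∀ {A : Set} {h : A → List (PS n)} {H : A → List (FPS n)} →
                 (∀ x → Pointwise _≡ᵛ_ (h x) (H x)) → ∀ xs → Pointwise _≡ᵛ_ (concatMap h xs) (concatMap H xs)
  ≡ᵛ-concatMap h≡H xs = Pointwise.concat⁺ (Pointwise.map⁺ _ _ (Pointwise.refl (λ {x} → h≡H x) {xs}))

  ≡ᵛ-if : ∀ b {f F} → f ≡ᵛ F → Pointwise _≡ᵛ_ (if b then [] else f ∷ []) (if b then [] else F ∷ [])
  ≡ᵛ-if true  f≡F = []
  ≡ᵛ-if false f≡F = f≡F ∷ []

  infix 4 _≡ᶻ_
  _≡ᶻ_ : PSz n → (ℕ → FPS n) → Set
  f ≡ᶻ F = ∀ m → f m ≡ᵛ F m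

  ≡ᶻ-* : ∀ {f g F G} → f ≡ᶻ F → g ≡ᶻ G → f *z g ≡ᶻ PowerSeries._⊛_ (FPS-ring n) F G
  ≡ᶻ-* f≡F g≡G m = ≡ᵛ-Σ (≡ᵛ-map (λ k → ≡ᵛ-* (f≡F k) (g≡G (m ∸ k))) (upTo (suc m)))

  oneMinusZx≡ᶻ : ∀ i → oneMinusZx i ≡ᶻ OmegaExpansion.oneMinusZxˢ n i
  oneMinusZx≡ᶻ i zero          = ≡ᵛ-const 1ᶠ
  oneMinusZx≡ᶻ i (suc zero)    = ≡ᵛ-neg (≡ᵛ-var i)
  oneMinusZx≡ᶻ i (suc (suc m)) = valuewise λ _ → ≡.refl

  geomQZx≡ᶻ : ∀ i → geomQZx i ≡ᶻ OmegaExpansion.geomˢ n i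
  geomQZx≡ᶻ i = ≡ᵛ-^ (≡ᵛ-· qᶠ ≡.refl (≡ᵛ-var i))

  Omega≡ᶻ : Omega n ≡ᶻ OmegaExpansion.Ωˢ n
  Omega≡ᶻ = foldr-≡ᶻ (allFin n)
    where
    open OmegaExpansion n using (oneMinusZxˢ; geomˢ)
    module Z = PowerSeries (FPS-ring n)
    1z≡ᶻ : 1z ≡ᶻ Z.𝟙
    1z≡ᶻ zero    = ≡ᵛ-const 1ᶠ
    1z≡ᶻ (suc m) = valuewise λ _ → ≡.refl
    foldr-≡ᶻ : ∀ is → foldr (λ i acc → (oneMinusZx i *z geomQZx i) *z acc) 1z is
                      ≡ᶻ foldr (λ i acc → (oneMinusZxˢ i Z.⊛ geomˢ i) Z.⊛ acc) Z.𝟙 is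
    foldr-≡ᶻ []       = 1z≡ᶻ
    foldr-≡ᶻ (i ∷ is) = ≡ᶻ-* (≡ᶻ-* (oneMinusZx≡ᶻ i) (geomQZx≡ᶻ i)) (foldr-≡ᶻ is)

module RawStatement (n : ℕ) (c : ℕ → K) (c≉0 : ∀ k → NonZeroDen (c k)) (v : ℕ) where
  cᶠ : ℕ → Frac
  cᶠ k = frac (c k) (c≉0 k)

  open Expansion n cᶠ v public using (proposition4p3ˢ)
  open Expansion n cᶠ v using (χᶠ; Dallˢ; Dexceptˢ; numProdˢ; evalQxˢ; lhsCoeffˢ; rhsSumˢ)

  difference≡ᵛ : ∀ p → diffS p ≡ᵛ ListEncodings.difference (FPS-ring n) varˢ p
  difference≡ᵛ (a , b) = ≡ᵛ-- (≡ᵛ-var a) (≡ᵛ-var b)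

  Dall≡ᵛ : Dall n ≡ᵛ Dallˢ
  Dall≡ᵛ = ≡ᵛ-Π (≡ᵛ-map difference≡ᵛ (pairsExcept (λ _ → false)))

  Dexcept≡ᵛ : ∀ i → Dexcept i ≡ᵛ Dexceptˢ i
  Dexcept≡ᵛ i = ≡ᵛ-Π (≡ᵛ-map difference≡ᵛ (pairsExcept (λ a → does (a Fin.≟ i))))

  numProd≡ᵛ : ∀ i → numProd i ≡ᵛ numProdˢ i
  numProd≡ᵛ i = ≡ᵛ-Π (≡ᵛ-concatMap (λ j → ≡ᵛ-if (does (j Fin.≟ i)) (≡ᵛ-- (≡ᵛ-· qᶠ ≡.refl (≡ᵛ-var i)) (≡ᵛ-var j)))
                                   (allFin n))

  χ0≡ : ∀ v → χ0 v ≡ val (χᶠ v)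
  χ0≡ zero    = ≡.refl
  χ0≡ (suc v) = ≡.refl

  lhs≡ᵛ : (qK ^K n) ·S (Dall n *S lhsCoeff n c v) ≡ᵛ (qᶠ F.^ n) ·ˢ (Dallˢ *ˢ lhsCoeffˢ)
  lhs≡ᵛ = ≡ᵛ-· (qᶠ F.^ n) (≡.sym (val-^ qᶠ n))
                (≡ᵛ-* Dall≡ᵛ (≡ᵛ-sumInf (λ k → ≡ᵛ-· (cᶠ k) ≡.refl (Omega≡ᶻ (v ℕ.+ k)))))

  rhs≡ᵛ : (χ0 v ·S (Dall n *S constS (c 0)))
            +S ((qK -K 1K) ·S sumS (map (λ i → numProd i *S (Dexcept i *S (((qK ·S varS i) ^S v) *S evalQx c i))) (allFin n)))
          ≡ᵛ (χᶠ v ·ˢ (Dallˢ *ˢ constˢ (cᶠ 0)))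
            +ˢ ((qᶠ +ᶠ (-ᶠ 1ᶠ)) ·ˢ rhsSumˢ)
  rhs≡ᵛ = ≡ᵛ-+ (≡ᵛ-· (χᶠ v) (χ0≡ v) (≡ᵛ-* Dall≡ᵛ (≡ᵛ-const (cᶠ 0))))
               (≡ᵛ-· (qᶠ +ᶠ (-ᶠ 1ᶠ)) ≡.refl (≡ᵛ-Σ (≡ᵛ-map (λ i → ≡ᵛ-* (numProd≡ᵛ i) (≡ᵛ-* (Dexcept≡ᵛ i)
                 (≡ᵛ-* (geomQZx≡ᶻ i v) (≡ᵛ-sumInf (λ k → ≡ᵛ-· (cᶠ k) ≡.refl (geomQZx≡ᶻ i k)))))) (allFin n))))

proposition4p3 : (n : ℕ) (c : ℕ → K) (v : ℕ) → (∀ k → NonZeroDen (c k)) →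
    ((qK ^K n) ·S (Dall n *S lhsCoeff n c v))
    ≈S
    ((χ0 v ·S (Dall n *S constS (c 0)))
    +S ((qK -K 1K) ·S sumS (map (λ i → numProd i *S (Dexcept i *S (((qK ·S varS i) ^S v) *S evalQx c i))) (allFin n))))
proposition4p3 n c v c≉0 α =
  ≡.subst₂ _≈K_ (≡.sym (coeff-≡ lhs≡ᵛ α)) (≡.sym (coeff-≡ rhs≡ᵛ α)) (≈ᶠ⇒≈K (coeff proposition4p3ˢ α))
  where open RawStatement n c c≉0 v
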